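{- Let $r\ge1$, $p_1,\dots,p_r\in\mathbb{P}$, $N=p_1+\cdots+p_r$, and let $I_k$ denote the $k$-element chain. Let $M=\{1^{p_1},2^{p_2},\dots,r^{p_r}\}$ be the multiset with $p_i$ copies of $i$, let $\mathfrak{S}_M$ be the set of all words (multipermutations) $\pi=\pi_1\cdots\pi_N$ that are rearrangements of $M$, let $\mathrm{des}(\pi)=\#\{j<N:\pi_j>\pi_{j+1}\}$, and let $A_{M,r}(x)=\sum_{\pi\in\mathfrak{S}_M}x^{\mathrm{des}(\pi)}$. Then \[ \mathrm{Ehr}(\mathcal{O}(I_1\oplus(I_{p_1}+I_{p_2}+\cdots+I_{p_r})\oplus I_1),x)=\frac{A_{M,r}(x)}{(1-x)^{N+3}}. \]
   Context: For a finite poset $(P,\preceq)$ on $[p]$, the order polytope $\mathcal{O}(P)\subset\mathbb{R}^p$ is defined by $0\le x_i\le 1$ and $x_i\le x_j$ whenever $i\prec j$. For an integral polytope $\mathcal{Q}\subset\mathbb{R}^p$, $\mathrm{ehr}(\mathcal{Q},n)=|n\mathcal{Q}\cap\mathbb{Z}^p|$ ($n\ge1$), and $\mathrm{Ehr}(\mathcal{Q},x)=1+\sum_{n\ge1}\mathrm{ehr}(\mathcal{Q},n)x^n$. The direct sum $P_1+P_2$ is the disjoint union with no relations between $P_1$ and $P_2$; the ordinal sum $P_1\oplus P_2$ is the disjoint union keeping the orders of $P_1,P_2$ and declaring every element of $P_1$ below every element of $P_2$. -}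

module Defs where

open import Data.Nat as ℕ using (ℕ; zero; suc; _∸_)
open import Data.Integer as ℤ using (ℤ; +_)
open import Data.Fin as Fin using (Fin; toℕ; splitAt)
open import Data.Fin.Properties using (all?; _≟_)
open import Data.List using (List; []; _∷_; length; filter; map; concatMap; allFin)
open import Data.Vec.Functional as VF using ()
open import Data.Sum using (_⊎_; inj₁; inj₂)
open import Data.Unit using (⊤)
open import Data.Empty using (⊥)
open import Relation.Nullary using (Dec; yes; no)
open import Relation.Nullary.Decidable using (_→-dec_)
open import Relation.Binary using (Decidable)
open import Relation.Unary as U using ()
open import Relation.Binary.PropositionalEquality using (_≡_)
open import Data.Bool using (if_then_else_)
open import Relation.Nullary.Decidable using (does)

-- Finite posets on [m] = Fin m, given by their strict order relation
-- (decidable).  The order polytope only uses the relation i ≺ j.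

record FinPoset : Set₁ where
  field
    size : ℕ
    _≺_  : Fin size → Fin size → Set
    _≺?_ : Decidable _≺_
open FinPoset public

chain : ℕ → FinPoset
chain k = record { size = k ; _≺_ = Fin._<_ ; _≺?_ = Fin._<?_ }

emptyP : FinPoset
emptyP = record { size = 0 ; _≺_ = λ () ; _≺?_ = λ () }

sumRel : (P Q : FinPoset) → Fin (size P) ⊎ Fin (size Q) → Fin (size P) ⊎ Fin (size Q) → Set
sumRel P Q (inj₁ a) (inj₁ b) = _≺_ P a b
sumRel P Q (inj₂ a) (inj₂ b) = _≺_ Q a b
sumRel P Q (inj₁ _) (inj₂ _) = ⊥
sumRel P Q (inj₂ _) (inj₁ _) = ⊥

sumRel? : (P Q : FinPoset) → Decidable (sumRel P Q)
sumRel? P Q (inj₁ a) (inj₁ b) = _≺?_ P a b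
sumRel? P Q (inj₂ a) (inj₂ b) = _≺?_ Q a b
sumRel? P Q (inj₁ _) (inj₂ _) = no λ ()
sumRel? P Q (inj₂ _) (inj₁ _) = no λ ()

_+P_ : FinPoset → FinPoset → FinPoset
P +P Q = record
  { size = size P ℕ.+ size Q
  ; _≺_  = λ i j → sumRel P Q (splitAt (size P) i) (splitAt (size P) j)
  ; _≺?_ = λ i j → sumRel? P Q (splitAt (size P) i) (splitAt (size P) j)
  }

ordRel : (P Q : FinPoset) → Fin (size P) ⊎ Fin (size Q) → Fin (size P) ⊎ Fin (size Q) → Set
ordRel P Q (inj₁ a) (inj₁ b) = _≺_ P a b
ordRel P Q (inj₂ a) (inj₂ b) = _≺_ Q a b
ordRel P Q (inj₁ _) (inj₂ _) = ⊤
ordRel P Q (inj₂ _) (inj₁ _) = ⊥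

ordRel? : (P Q : FinPoset) → Decidable (ordRel P Q)
ordRel? P Q (inj₁ a) (inj₁ b) = _≺?_ P a b
ordRel? P Q (inj₂ a) (inj₂ b) = _≺?_ Q a b
ordRel? P Q (inj₁ _) (inj₂ _) = yes _
ordRel? P Q (inj₂ _) (inj₁ _) = no λ ()

_⊕P_ : FinPoset → FinPoset → FinPoset
P ⊕P Q = record
  { size = size P ℕ.+ size Q
  ; _≺_  = λ i j → ordRel P Q (splitAt (size P) i) (splitAt (size P) j)
  ; _≺?_ = λ i j → ordRel? P Q (splitAt (size P) i) (splitAt (size P) j)
  }

sumChains : (r : ℕ) → (Fin r → ℕ) → FinPoset
sumChains zero    p = emptyP
sumChains (suc r) p = chain (p Fin.zero) +P sumChains r (λ i → p (Fin.suc i))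

-- Lattice points of n·O(P): integer vectors x ∈ ℤ^[m] with 0 ≤ x_i ≤ n
-- and x_i ≤ x_j whenever i ≺ j, i.e. maps x : Fin m → Fin (n+1)
-- (values read via toℕ) satisfying the order constraints.

allFuns : (m k : ℕ) → List (Fin m → Fin k)
allFuns zero    k = (λ ()) ∷ []
allFuns (suc m) k = concatMap (λ a → map (λ f → a VF.∷ f) (allFuns m k)) (allFin k)

InDilatedOrderPolytope : (P : FinPoset) (n : ℕ) → (Fin (size P) → Fin (suc n)) → Set
InDilatedOrderPolytope P n x = ∀ i j → _≺_ P i j → toℕ (x i) ℕ.≤ toℕ (x j)

inDilated? : (P : FinPoset) (n : ℕ) → U.Decidable (InDilatedOrderPolytope P n)
inDilated? P n x = all? λ i → all? λ j → _≺?_ P i j →-dec (toℕ (x i) ℕ.≤? toℕ (x j))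

ehr : FinPoset → ℕ → ℕ
ehr P n = length (filter (inDilated? P n) (allFuns (size P) (suc n)))

Series : Set
Series = ℕ → ℤ

sumTo : ℕ → (ℕ → ℤ) → ℤ
sumTo zero    h = h 0
sumTo (suc n) h = sumTo n h ℤ.+ h (suc n)

_*S_ : Series → Series → Series
(f *S g) n = sumTo n (λ k → f k ℤ.* g (n ∸ k))

oneS : Series
oneS zero    = + 1
oneS (suc _) = + 0

oneMinusX : Series
oneMinusX zero          = + 1
oneMinusX (suc zero)    = ℤ.- (+ 1)
oneMinusX (suc (suc _)) = + 0

_^S_ : Series → ℕ → Series
f ^S zero  = oneS
f ^S suc k = f *S (f ^S k)

Ehr : FinPoset → Series
Ehr P zero    = + 1
Ehr P (suc n) = + ehr P (suc n)

-- Multipermutations of M = {1^{p_1}, ..., r^{p_r}} (letters Fin r,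
-- letter i standing for i+1), descents, and A_{M,r}(x).

allWords : (r N : ℕ) → List (List (Fin r))
allWords r zero    = [] ∷ []
allWords r (suc N) = concatMap (λ a → map (a ∷_) (allWords r N)) (allFin r)

occ : {r : ℕ} → Fin r → List (Fin r) → ℕ
occ i w = length (filter (_≟ i) w)

IsRearrangement : {r : ℕ} → (Fin r → ℕ) → List (Fin r) → Set
IsRearrangement p w = ∀ i → occ i w ≡ p i

isRearrangement? : {r : ℕ} (p : Fin r → ℕ) → U.Decidable (IsRearrangement p)
isRearrangement? p w = all? λ i → occ i w ℕ.≟ p i

des : {r : ℕ} → List (Fin r) → ℕ
des []            = 0
des (a ∷ [])      = 0
des (a ∷ b ∷ w)   = (if does (b Fin.<? a) then 1 else 0) ℕ.+ des (b ∷ w)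

total : (r : ℕ) → (Fin r → ℕ) → ℕ
total zero    p = 0
total (suc r) p = p Fin.zero ℕ.+ total r (λ i → p (Fin.suc i))

multiperms : (r : ℕ) → (Fin r → ℕ) → List (List (Fin r))
multiperms r p = filter (isRearrangement? p) (allWords r (total r p))

eulerianM : (r : ℕ) → (Fin r → ℕ) → Series
eulerianM r p d = + length (filter (λ π → des π ℕ.≟ d) (multiperms r p))

-- Write P = I₁ ⊕ S ⊕ I₁ with S = I_{p₁} + ⋯ + I_{pᵣ}. A lattice point of n·O(P) is a choice of
-- values a ≤ b ≤ n for the bottom and the top of P together with, independently for every j,
-- a weakly increasing sequence of length pⱼ in [a, b]; there are ((b - a + 1 multichoose pⱼ)) of
-- those. So ehr(P, n) = Σ_{b ≤ n} Σ_{t ≤ b} F t with F t = Πⱼ ((t + 1 multichoose pⱼ)), and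
-- MacMahon's identity F t = Σ_{π ∈ 𝔖_M} [xᵗ] x^{des π} / (1 - x)^{N+1} turns ehr(P, n) into the
-- n-th coefficient of A_{M,r}(x) / (1 - x)^{N+3}; multiplication by (1 - x)^{N+3} undoes the
-- N + 3 partial sums.
--
-- MacMahon's identity is proved by interpolating both sides in a letter i ≤ r: in the product
-- the letters below i get one value fewer, in the sum every word is preceded by the letter i.
-- Both interpolations satisfy the same recursion (remove a copy of the letter i, pass from i to
-- i + 1, or wrap around from (t + 1, r) to (t, 0)), and that recursion determines them.

module Submission where

open import Defs
open import Data.Nat as ℕ using (ℕ; zero; suc; _+_; _*_; _∸_; _≤_; _<_; _≥_; z≤n; s≤s; pred; NonZero)
open import Data.Nat.Properties
open import Data.Integer as ℤ using (ℤ)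
import Data.Integer.Properties as ℤₚ
import Data.Integer.Tactic.RingSolver as ℤ-Solver
open import Data.Fin as Fin using (Fin; toℕ; splitAt; join)
import Data.Fin.Properties as Finₚ
open import Data.Vec.Functional as VF using (updateAt)
open import Data.Vec.Functional.Properties using (updateAt-updates; updateAt-minimal)
open import Data.List.Properties using (filter-accept; filter-reject)
open import Data.List using (List; []; _∷_; _++_; length; filter; map; concatMap; allFin; tabulate)
open import Data.Bool using (true; false; if_then_else_)
open import Data.Sum using (_⊎_; inj₁; inj₂; [_,_])
open import Data.Product using (_×_; _,_; proj₁; proj₂)
open import Relation.Nullary using (Dec; yes; no; does; ¬_)
open import Relation.Nullary.Decidable using (_×-dec_)
open import Relation.Nullary.Negation using (contradiction)
open import Relation.Unary as U using ()
open import Relation.Binary using (Decidable)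
open import Relation.Binary.PropositionalEquality hiding ([_])
open import Function using (_∘_; _⇔_; mk⇔; Equivalence)
open import Function.Properties.Equivalence using () renaming (trans to ⇔-trans)
open import Algebra.Properties.CommutativeSemigroup +-commutativeSemigroup
  using (interchange; xy∙z≈xz∙y)
open import Algebra.Properties.CommutativeMonoid.Sum +-0-commutativeMonoid as FinSum
  using (sum; sum-syntax; sum⁺-syntax; sum-cong-≗; sum-replicate-zero)


𝟙 : ∀ {p} {P : Set p} → Dec P → ℕ
𝟙 P? = if does P? then 1 else 0

module _ {p q} {P : Set p} {Q : Set q} where

  𝟙-cong : P ⇔ Q → (P? : Dec P) (Q? : Dec Q) → 𝟙 P? ≡ 𝟙 Q?
  𝟙-cong P⇔Q (yes _) (yes _) = refl
  𝟙-cong P⇔Q (yes p) (no ¬q) = contradiction (Equivalence.to P⇔Q p) ¬q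
  𝟙-cong P⇔Q (no ¬p) (yes q) = contradiction (Equivalence.from P⇔Q q) ¬p
  𝟙-cong P⇔Q (no _)  (no _)  = refl

  𝟙-× : (P? : Dec P) (Q? : Dec Q) → 𝟙 (P? ×-dec Q?) ≡ 𝟙 P? * 𝟙 Q?
  𝟙-× (yes _) (yes _) = refl
  𝟙-× (yes _) (no _)  = refl
  𝟙-× (no _)  _       = refl

  𝟙-*-exclusive : (P → ¬ Q) → (P? : Dec P) (Q? : Dec Q) → 𝟙 P? * 𝟙 Q? ≡ 0
  𝟙-*-exclusive P⇒¬Q (yes p) (yes q) = contradiction q (P⇒¬Q p)
  𝟙-*-exclusive P⇒¬Q (yes _) (no _)  = refl
  𝟙-*-exclusive P⇒¬Q (no _)  _       = refl

  𝟙-*-implied : (P → Q) → (P? : Dec P) (Q? : Dec Q) → 𝟙 P? * 𝟙 Q? ≡ 𝟙 P?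
  𝟙-*-implied P⇒Q (yes _) (yes _) = refl
  𝟙-*-implied P⇒Q (yes p) (no ¬q) = contradiction (P⇒Q p) ¬q
  𝟙-*-implied P⇒Q (no _)  _       = refl

𝟙-cong-× : ∀ {p q r} {P : Set p} {Q : Set q} {R : Set r} → P ⇔ (Q × R) →
           (P? : Dec P) (Q? : Dec Q) (R? : Dec R) → 𝟙 P? ≡ 𝟙 Q? * 𝟙 R?
𝟙-cong-× P⇔Q×R P? Q? R? = trans (𝟙-cong P⇔Q×R P? (Q? ×-dec R?)) (𝟙-× Q? R?)

module _ {p} {P : Set p} where

  𝟙-*-cong : ∀ {x y} → (P → x ≡ y) → (P? : Dec P) → 𝟙 P? * x ≡ 𝟙 P? * y
  𝟙-*-cong x≡y (yes p) = cong (1 *_) (x≡y p)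
  𝟙-*-cong x≡y (no _)  = refl

  𝟙-yes : (P? : Dec P) → P → 𝟙 P? ≡ 1
  𝟙-yes (yes _) _ = refl
  𝟙-yes (no ¬p) p = contradiction p ¬p

  𝟙-no : (P? : Dec P) → ¬ P → 𝟙 P? ≡ 0
  𝟙-no (yes p) ¬p = contradiction p ¬p
  𝟙-no (no _)  _  = refl

𝟙-s≤s : ∀ m n → 𝟙 (suc m ℕ.≤? suc n) ≡ 𝟙 (m ℕ.≤? n)
𝟙-s≤s m n = 𝟙-cong (mk⇔ ℕ.s≤s⁻¹ s≤s) (suc m ℕ.≤? suc n) (m ℕ.≤? n)

𝟙-≤-≢ : ∀ {m n} → m ≢ n → 𝟙 (m ℕ.≤? n) ≡ 𝟙 (suc m ℕ.≤? n)
𝟙-≤-≢ {m} {n} m≢n = 𝟙-cong (mk⇔ (λ m≤n → ≤∧≢⇒< m≤n m≢n) <⇒≤) (m ℕ.≤? n) (suc m ℕ.≤? n)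

𝟙-≤-split : ∀ m n → 𝟙 (m ℕ.≤? n) ≡ 𝟙 (suc m ℕ.≤? n) + 𝟙 (m ℕ.≟ n)
𝟙-≤-split m n = by-cases (m ℕ.≟ n)
  where
  by-cases : Dec (m ≡ n) → 𝟙 (m ℕ.≤? n) ≡ 𝟙 (suc m ℕ.≤? n) + 𝟙 (m ℕ.≟ n)
  by-cases (yes refl) = begin
    𝟙 (m ℕ.≤? m)                          ≡⟨ 𝟙-yes (m ℕ.≤? m) ≤-refl ⟩
    1                                     ≡⟨ cong₂ _+_ (𝟙-no (suc m ℕ.≤? m) (n≮n m)) (𝟙-yes (m ℕ.≟ m) refl) ⟨
    𝟙 (suc m ℕ.≤? m) + 𝟙 (m ℕ.≟ m)        ∎
    where open ≡-Reasoning
  by-cases (no m≢n)   = begin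
    𝟙 (m ℕ.≤? n)                          ≡⟨ 𝟙-≤-≢ m≢n ⟩
    𝟙 (suc m ℕ.≤? n)                      ≡⟨ +-identityʳ _ ⟨
    𝟙 (suc m ℕ.≤? n) + 0                  ≡⟨ cong (𝟙 (suc m ℕ.≤? n) +_) (𝟙-no (m ℕ.≟ n) m≢n) ⟨
    𝟙 (suc m ℕ.≤? n) + 𝟙 (m ℕ.≟ n)        ∎
    where open ≡-Reasoning


sumOver : ∀ {a} {A : Set a} → List A → (A → ℕ) → ℕ
sumOver []       h = 0
sumOver (x ∷ xs) h = h x + sumOver xs h

infix 10 sumOver
syntax sumOver xs (λ x → e) = ∑[ x ← xs ] e

module _ {a} {A : Set a} where

  ∑-cong : ∀ (xs : List A) {f g : A → ℕ} → (∀ x → f x ≡ g x) → ∑[ x ← xs ] f x ≡ ∑[ x ← xs ] g x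
  ∑-cong []       f≗g = refl
  ∑-cong (x ∷ xs) f≗g = cong₂ _+_ (f≗g x) (∑-cong xs f≗g)

  ∑-zero : ∀ (xs : List A) → ∑[ x ← xs ] 0 ≡ 0
  ∑-zero []       = refl
  ∑-zero (x ∷ xs) = ∑-zero xs

  ∑-++ : ∀ (xs ys : List A) (h : A → ℕ) → sumOver (xs ++ ys) h ≡ sumOver xs h + sumOver ys h
  ∑-++ []       ys h = refl
  ∑-++ (x ∷ xs) ys h = trans (cong (h x +_) (∑-++ xs ys h)) (sym (+-assoc (h x) _ _))

  ∑-distrib-+ : ∀ (xs : List A) (f g : A → ℕ) → ∑[ x ← xs ] (f x + g x) ≡ sumOver xs f + sumOver xs g
  ∑-distrib-+ []       f g = refl
  ∑-distrib-+ (x ∷ xs) f g = trans (cong (f x + g x +_) (∑-distrib-+ xs f g)) (interchange (f x) (g x) _ _)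

  ∑-*ˡ : ∀ (xs : List A) (c : ℕ) (h : A → ℕ) → ∑[ x ← xs ] (c * h x) ≡ c * sumOver xs h
  ∑-*ˡ []       c h = sym (*-zeroʳ c)
  ∑-*ˡ (x ∷ xs) c h = trans (cong (c * h x +_) (∑-*ˡ xs c h)) (sym (*-distribˡ-+ c (h x) _))

  ∑-*ʳ : ∀ (xs : List A) (c : ℕ) (h : A → ℕ) → ∑[ x ← xs ] (h x * c) ≡ sumOver xs h * c
  ∑-*ʳ xs c h = trans (∑-cong xs λ x → *-comm (h x) c) (trans (∑-*ˡ xs c h) (*-comm c _))

  ∑-filter : ∀ {p} {P : A → Set p} (P? : U.Decidable P) (xs : List A) (h : A → ℕ) →
             sumOver (filter P? xs) h ≡ ∑[ x ← xs ] (𝟙 (P? x) * h x)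
  ∑-filter P? []       h = refl
  ∑-filter P? (x ∷ xs) h with does (P? x)
  ... | true  = cong₂ _+_ (sym (+-identityʳ (h x))) (∑-filter P? xs h)
  ... | false = ∑-filter P? xs h

  length-filter : ∀ {p} {P : A → Set p} (P? : U.Decidable P) (xs : List A) →
                  length (filter P? xs) ≡ ∑[ x ← xs ] 𝟙 (P? x)
  length-filter P? []       = refl
  length-filter P? (x ∷ xs) with does (P? x)
  ... | true  = cong suc (length-filter P? xs)
  ... | false = length-filter P? xs

module _ {a b} {A : Set a} {B : Set b} where

  ∑-map : ∀ (g : A → B) (xs : List A) (h : B → ℕ) → sumOver (map g xs) h ≡ ∑[ x ← xs ] h (g x)
  ∑-map g []       h = refl
  ∑-map g (x ∷ xs) h = cong (h (g x) +_) (∑-map g xs h)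

  ∑-concatMap : ∀ (f : A → List B) (xs : List A) (h : B → ℕ) →
                sumOver (concatMap f xs) h ≡ ∑[ x ← xs ] sumOver (f x) h
  ∑-concatMap f []       h = refl
  ∑-concatMap f (x ∷ xs) h = trans (∑-++ (f x) (concatMap f xs) h) (cong (sumOver (f x) h +_) (∑-concatMap f xs h))

  ∑-comm : ∀ (xs : List A) (ys : List B) (h : A → B → ℕ) →
           ∑[ x ← xs ] ∑[ y ← ys ] h x y ≡ ∑[ y ← ys ] ∑[ x ← xs ] h x y
  ∑-comm []       ys h = sym (∑-zero ys)
  ∑-comm (x ∷ xs) ys h = trans (cong (sumOver ys (h x) +_) (∑-comm xs ys h)) (sym (∑-distrib-+ ys (h x) _))

∑-tabulate : ∀ {b} {B : Set b} {r} (g : Fin r → B) (h : B → ℕ) → sumOver (tabulate g) h ≡ ∑[ j < r ] h (g j)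
∑-tabulate {r = zero}  g h = refl
∑-tabulate {r = suc r} g h = cong (h (g Fin.zero) +_) (∑-tabulate (g ∘ Fin.suc) h)

∑-allFin : ∀ r (h : Fin r → ℕ) → ∑[ j ← allFin r ] h j ≡ ∑[ j < r ] h j
∑-allFin r h = ∑-tabulate (λ j → j) h

∑-update : ∀ {r} (i : Fin r) (f g : Fin r → ℕ) (c : ℕ) →
           (∀ j → j ≢ i → f j ≡ g j) → f i ≡ g i + c → ∑[ j < r ] f j ≡ ∑[ j < r ] g j + c
∑-update Fin.zero f g c f≡g fi≡gi+c = begin
  f Fin.zero + sum (f ∘ Fin.suc)     ≡⟨ cong₂ _+_ fi≡gi+c (sum-cong-≗ (λ j → f≡g (Fin.suc j) λ ())) ⟩
  g Fin.zero + c + sum (g ∘ Fin.suc) ≡⟨ xy∙z≈xz∙y (g Fin.zero) c _ ⟩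
  g Fin.zero + sum (g ∘ Fin.suc) + c ∎
  where open ≡-Reasoning
∑-update (Fin.suc i) f g c f≡g fi≡gi+c = begin
  f Fin.zero + sum (f ∘ Fin.suc)
    ≡⟨ cong₂ _+_ (f≡g Fin.zero λ ()) (∑-update i _ _ c (λ j j≢i → f≡g (Fin.suc j) (j≢i ∘ Finₚ.suc-injective)) fi≡gi+c) ⟩
  g Fin.zero + (sum (g ∘ Fin.suc) + c) ≡⟨ +-assoc (g Fin.zero) _ c ⟨
  g Fin.zero + sum (g ∘ Fin.suc) + c   ∎
  where open ≡-Reasoning

∏ : (r : ℕ) → (Fin r → ℕ) → ℕ
∏ zero    f = 1
∏ (suc r) f = f Fin.zero * ∏ r (f ∘ Fin.suc)

infix 10 ∏
syntax ∏ r (λ j → e) = ∏[ j < r ] e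

∏-cong : ∀ r {f g : Fin r → ℕ} → (∀ j → f j ≡ g j) → ∏ r f ≡ ∏ r g
∏-cong zero    f≗g = refl
∏-cong (suc r) f≗g = cong₂ _*_ (f≗g Fin.zero) (∏-cong r (f≗g ∘ Fin.suc))

∏-multilinear : ∀ {r} (i : Fin r) (f g h : Fin r → ℕ) →
                (∀ j → j ≢ i → f j ≡ g j) → (∀ j → j ≢ i → f j ≡ h j) → f i ≡ g i + h i →
                ∏ r f ≡ ∏ r g + ∏ r h
∏-multilinear {suc r} Fin.zero f g h f≡g f≡h fi = begin
  f Fin.zero * ∏ r (f ∘ Fin.suc)                    ≡⟨ cong₂ _*_ fi refl ⟩
  (g Fin.zero + h Fin.zero) * ∏ r (f ∘ Fin.suc)     ≡⟨ *-distribʳ-+ _ (g Fin.zero) (h Fin.zero) ⟩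
  g Fin.zero * ∏ r (f ∘ Fin.suc) + h Fin.zero * ∏ r (f ∘ Fin.suc)
    ≡⟨ cong₂ _+_ (cong (g Fin.zero *_) (∏-cong r λ j → f≡g (Fin.suc j) λ ()))
                 (cong (h Fin.zero *_) (∏-cong r λ j → f≡h (Fin.suc j) λ ())) ⟩
  g Fin.zero * ∏ r (g ∘ Fin.suc) + h Fin.zero * ∏ r (h ∘ Fin.suc) ∎
  where open ≡-Reasoning
∏-multilinear {suc r} (Fin.suc i) f g h f≡g f≡h fi = begin
  f Fin.zero * ∏ r (f ∘ Fin.suc)
    ≡⟨ cong (f Fin.zero *_) (∏-multilinear i _ _ _ (λ j j≢i → f≡g (Fin.suc j) (j≢i ∘ Finₚ.suc-injective))
                                                  (λ j j≢i → f≡h (Fin.suc j) (j≢i ∘ Finₚ.suc-injective)) fi) ⟩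
  f Fin.zero * (∏ r (g ∘ Fin.suc) + ∏ r (h ∘ Fin.suc))
    ≡⟨ *-distribˡ-+ (f Fin.zero) _ _ ⟩
  f Fin.zero * ∏ r (g ∘ Fin.suc) + f Fin.zero * ∏ r (h ∘ Fin.suc)
    ≡⟨ cong₂ _+_ (cong (_* ∏ r (g ∘ Fin.suc)) (f≡g Fin.zero λ ())) (cong (_* ∏ r (h ∘ Fin.suc)) (f≡h Fin.zero λ ())) ⟩
  g Fin.zero * ∏ r (g ∘ Fin.suc) + h Fin.zero * ∏ r (h ∘ Fin.suc) ∎
  where open ≡-Reasoning


-- Formal power series

Δ : Series → Series
Δ f zero    = f zero
Δ f (suc n) = f (suc n) ℤ.- f n

Δ^ : ℕ → Series → Series
Δ^ zero    f = f
Δ^ (suc k) f = Δ (Δ^ k f)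

Δ-cong : ∀ {f g} → f ≗ g → Δ f ≗ Δ g
Δ-cong f≗g zero    = f≗g zero
Δ-cong f≗g (suc n) = cong₂ ℤ._-_ (f≗g (suc n)) (f≗g n)

Δ^-cong : ∀ k {f g} → f ≗ g → Δ^ k f ≗ Δ^ k g
Δ^-cong zero    f≗g = f≗g
Δ^-cong (suc k) f≗g = Δ-cong (Δ^-cong k f≗g)

Δ^-comm : ∀ k f → Δ^ k (Δ f) ≗ Δ (Δ^ k f)
Δ^-comm zero    f = λ _ → refl
Δ^-comm (suc k) f = Δ-cong (Δ^-comm k f)

sumTo-cong : ∀ n {f g : ℕ → ℤ} → (∀ k → k ≤ n → f k ≡ g k) → sumTo n f ≡ sumTo n g
sumTo-cong zero    f≡g = f≡g 0 z≤n
sumTo-cong (suc n) f≡g = cong₂ ℤ._+_ (sumTo-cong n λ k k≤n → f≡g k (m≤n⇒m≤1+n k≤n)) (f≡g (suc n) ≤-refl)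

sumTo-zero : ∀ n → sumTo n (λ _ → ℤ.+ 0) ≡ ℤ.+ 0
sumTo-zero zero    = refl
sumTo-zero (suc n) = cong (ℤ._+ ℤ.+ 0) (sumTo-zero n)

sumTo-suc : ∀ n f → sumTo (suc n) f ≡ f 0 ℤ.+ sumTo n (f ∘ suc)
sumTo-suc zero    f = refl
sumTo-suc (suc n) f = trans (cong (ℤ._+ f (2 + n)) (sumTo-suc n f)) (ℤₚ.+-assoc (f 0) _ _)

sumTo-distrib-- : ∀ n f g → sumTo n (λ k → f k ℤ.- g k) ≡ sumTo n f ℤ.- sumTo n g
sumTo-distrib-- zero    f g = refl
sumTo-distrib-- (suc n) f g = trans (cong (ℤ._+ (f (suc n) ℤ.- g (suc n))) (sumTo-distrib-- n f g))
                                    (-+--interchange (sumTo n f) (sumTo n g) (f (suc n)) (g (suc n)))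
  where
  -+--interchange : ∀ w x y z → (w ℤ.- x) ℤ.+ (y ℤ.- z) ≡ (w ℤ.+ y) ℤ.- (x ℤ.+ z)
  -+--interchange = ℤ-Solver.solve-∀

*S-congʳ : ∀ f {g h} → g ≗ h → f *S g ≗ f *S h
*S-congʳ f g≗h n = sumTo-cong n λ k _ → cong (f k ℤ.*_) (g≗h (n ∸ k))

*S-oneS : ∀ f → f *S oneS ≗ f
*S-oneS f zero    = ℤₚ.*-identityʳ (f 0)
*S-oneS f (suc m) = begin
  sumTo m (λ k → f k ℤ.* oneS (suc m ∸ k)) ℤ.+ f (suc m) ℤ.* oneS (m ∸ m)
    ≡⟨ cong₂ ℤ._+_ (trans (sumTo-cong m vanishes) (sumTo-zero m)) (cong (λ j → f (suc m) ℤ.* oneS j) (n∸n≡0 m)) ⟩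
  ℤ.+ 0 ℤ.+ f (suc m) ℤ.* ℤ.+ 1
    ≡⟨ trans (ℤₚ.+-identityˡ _) (ℤₚ.*-identityʳ (f (suc m))) ⟩
  f (suc m) ∎
  where
  open ≡-Reasoning
  vanishes : ∀ k → k ≤ m → f k ℤ.* oneS (suc m ∸ k) ≡ ℤ.+ 0
  vanishes k k≤m rewrite +-∸-assoc 1 k≤m = ℤₚ.*-zeroʳ (f k)

oneMinusX-*S : ∀ g → oneMinusX *S g ≗ Δ g
oneMinusX-*S g zero    = ℤₚ.*-identityˡ (g 0)
oneMinusX-*S g (suc m) =
  trans (sumTo-suc m _) (cong₂ ℤ._+_ (ℤₚ.*-identityˡ (g (suc m))) (tail m))
  where
  tail : ∀ m → sumTo m (λ k → oneMinusX (suc k) ℤ.* g (m ∸ k)) ≡ ℤ.- g m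
  tail zero    = ℤₚ.-1*i≡-i (g 0)
  tail (suc m) = begin
    sumTo (suc m) (λ k → oneMinusX (suc k) ℤ.* g (suc m ∸ k))
      ≡⟨ sumTo-suc m _ ⟩
    ℤ.-1ℤ ℤ.* g (suc m) ℤ.+ sumTo m (λ _ → ℤ.+ 0)
      ≡⟨ cong₂ ℤ._+_ (ℤₚ.-1*i≡-i (g (suc m))) (sumTo-zero m) ⟩
    ℤ.- g (suc m) ℤ.+ ℤ.+ 0
      ≡⟨ ℤₚ.+-identityʳ _ ⟩
    ℤ.- g (suc m) ∎
    where open ≡-Reasoning

*S-Δ : ∀ f g → f *S Δ g ≗ Δ (f *S g)
*S-Δ f g zero    = refl
*S-Δ f g (suc m) = begin
  sumTo m (λ k → f k ℤ.* Δ g (suc m ∸ k)) ℤ.+ f (suc m) ℤ.* Δ g (m ∸ m)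
    ≡⟨ cong₂ ℤ._+_ (trans (sumTo-cong m split) (sumTo-distrib-- m _ _)) (cong (λ j → f (suc m) ℤ.* Δ g j) (n∸n≡0 m)) ⟩
  (A ℤ.- B) ℤ.+ f (suc m) ℤ.* g 0
    ≡⟨ -+-comm A B _ ⟩
  (A ℤ.+ f (suc m) ℤ.* g 0) ℤ.- B
    ≡⟨ cong (λ j → (A ℤ.+ f (suc m) ℤ.* g j) ℤ.- B) (sym (n∸n≡0 m)) ⟩
  (A ℤ.+ f (suc m) ℤ.* g (m ∸ m)) ℤ.- B ∎
  where
  open ≡-Reasoning
  A B : ℤ
  A = sumTo m (λ k → f k ℤ.* g (suc m ∸ k))
  B = sumTo m (λ k → f k ℤ.* g (m ∸ k))
  *-distribˡ-- : ∀ x a b → x ℤ.* (a ℤ.- b) ≡ x ℤ.* a ℤ.- x ℤ.* b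
  *-distribˡ-- = ℤ-Solver.solve-∀
  -+-comm : ∀ a b c → (a ℤ.- b) ℤ.+ c ≡ (a ℤ.+ c) ℤ.- b
  -+-comm = ℤ-Solver.solve-∀
  split : ∀ k → k ≤ m → f k ℤ.* Δ g (suc m ∸ k) ≡ f k ℤ.* g (suc m ∸ k) ℤ.- f k ℤ.* g (m ∸ k)
  split k k≤m rewrite +-∸-assoc 1 k≤m = *-distribˡ-- (f k) _ _

*S-oneMinusX^ : ∀ k f → f *S (oneMinusX ^S k) ≗ Δ^ k f
*S-oneMinusX^ zero    f n = *S-oneS f n
*S-oneMinusX^ (suc k) f n = begin
  (f *S (oneMinusX *S (oneMinusX ^S k))) n ≡⟨ *S-congʳ f (oneMinusX-*S (oneMinusX ^S k)) n ⟩
  (f *S Δ (oneMinusX ^S k)) n              ≡⟨ *S-Δ f (oneMinusX ^S k) n ⟩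
  Δ (f *S (oneMinusX ^S k)) n              ≡⟨ Δ-cong (*S-oneMinusX^ k f) n ⟩
  Δ^ (suc k) f n                           ∎
  where open ≡-Reasoning


-- As coefficient sequences psum f = f / (1 - x), shift f = x f and monomial d = xᵈ, so
-- psum^ k (monomial d) lists the coefficients of xᵈ / (1 - x)ᵏ.
psum : (ℕ → ℕ) → ℕ → ℕ
psum g zero    = g 0
psum g (suc n) = psum g n + g (suc n)

psum^ : ℕ → (ℕ → ℕ) → ℕ → ℕ
psum^ zero    g = g
psum^ (suc k) g = psum (psum^ k g)

shift : (ℕ → ℕ) → ℕ → ℕ
shift g zero    = 0
shift g (suc n) = g n

monomial : ℕ → ℕ → ℕ
monomial d n = 𝟙 (d ℕ.≟ n)

psum-cong : ∀ {f g} → f ≗ g → psum f ≗ psum g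
psum-cong f≗g zero    = f≗g 0
psum-cong f≗g (suc n) = cong₂ _+_ (psum-cong f≗g n) (f≗g (suc n))

psum^-cong : ∀ k {f g} → f ≗ g → psum^ k f ≗ psum^ k g
psum^-cong zero    f≗g = f≗g
psum^-cong (suc k) f≗g = psum-cong (psum^-cong k f≗g)

psum^-zero : ∀ k g → psum^ k g 0 ≡ g 0
psum^-zero zero    g = refl
psum^-zero (suc k) g = psum^-zero k g

Δ-psum : ∀ g → Δ (ℤ.+_ ∘ psum g) ≗ ℤ.+_ ∘ g
Δ-psum g zero    = refl
Δ-psum g (suc n) = begin
  ℤ.+ (psum g n + g (suc n)) ℤ.- ℤ.+ psum g n   ≡⟨ cong (ℤ._- ℤ.+ psum g n) (ℤₚ.pos-+ (psum g n) (g (suc n))) ⟩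
  ℤ.+ psum g n ℤ.+ ℤ.+ g (suc n) ℤ.- ℤ.+ psum g n ≡⟨ +--cancel (ℤ.+ psum g n) (ℤ.+ g (suc n)) ⟩
  ℤ.+ g (suc n) ∎
  where
  open ≡-Reasoning
  +--cancel : ∀ a b → a ℤ.+ b ℤ.- a ≡ b
  +--cancel = ℤ-Solver.solve-∀

Δ^-psum^ : ∀ k g → Δ^ k (ℤ.+_ ∘ psum^ k g) ≗ ℤ.+_ ∘ g
Δ^-psum^ zero    g n = refl
Δ^-psum^ (suc k) g n = begin
  Δ (Δ^ k (ℤ.+_ ∘ psum (psum^ k g))) n   ≡⟨ sym (Δ^-comm k _ n) ⟩
  Δ^ k (Δ (ℤ.+_ ∘ psum (psum^ k g))) n   ≡⟨ Δ^-cong k (Δ-psum (psum^ k g)) n ⟩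
  Δ^ k (ℤ.+_ ∘ psum^ k g) n              ≡⟨ Δ^-psum^ k g n ⟩
  ℤ.+ g n                                ∎
  where open ≡-Reasoning

psum-∑ : ∀ {a} {A : Set a} (xs : List A) (f : A → ℕ → ℕ) →
         psum (λ n → ∑[ x ← xs ] f x n) ≗ λ n → ∑[ x ← xs ] psum (f x) n
psum-∑ xs f zero    = refl
psum-∑ xs f (suc n) = trans (cong (_+ ∑[ x ← xs ] f x (suc n)) (psum-∑ xs f n))
                            (sym (∑-distrib-+ xs (λ x → psum (f x) n) (λ x → f x (suc n))))

psum^-∑ : ∀ {a} {A : Set a} k (xs : List A) (f : A → ℕ → ℕ) →
          psum^ k (λ n → ∑[ x ← xs ] f x n) ≗ λ n → ∑[ x ← xs ] psum^ k (f x) n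
psum^-∑ zero    xs f n = refl
psum^-∑ (suc k) xs f n = trans (psum-cong (psum^-∑ k xs f) n) (psum-∑ xs (psum^ k ∘ f) n)

psum-shift : ∀ g → psum (shift g) ≗ shift (psum g)
psum-shift g zero          = refl
psum-shift g (suc zero)    = refl
psum-shift g (suc (suc n)) = cong (_+ g (suc n)) (psum-shift g (suc n))

psum^-shift : ∀ k g → psum^ k (shift g) ≗ shift (psum^ k g)
psum^-shift zero    g n = refl
psum^-shift (suc k) g n = trans (psum-cong (psum^-shift k g) n) (psum-shift (psum^ k g) n)

psum-unfold : ∀ g n → psum g n ≡ shift (psum g) n + g n
psum-unfold g zero    = refl
psum-unfold g (suc n) = refl

monomial-suc : ∀ d → monomial (suc d) ≗ shift (monomial d)
monomial-suc d zero    = refl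
monomial-suc d (suc n) = refl

psum^-monomial-suc : ∀ k d → psum^ k (monomial (suc d)) ≗ shift (psum^ k (monomial d))
psum^-monomial-suc k d n = trans (psum^-cong k (monomial-suc d) n) (psum^-shift k (monomial d) n)

psum^-monomial-unfold : ∀ k d n →
  psum^ (suc k) (monomial d) n ≡ psum^ (suc k) (monomial (suc d)) n + psum^ k (monomial d) n
psum^-monomial-unfold k d n = trans (psum-unfold (psum^ k (monomial d)) n)
                                    (cong (_+ psum^ k (monomial d) n) (sym (psum^-monomial-suc (suc k) d n)))

psum-monomial-zero : ∀ n → psum (monomial 0) n ≡ 1
psum-monomial-zero zero    = refl
psum-monomial-zero (suc n) = cong (_+ 0) (psum-monomial-zero n)

psum-suc : ∀ (f : ℕ → ℕ) b → psum f (suc b) ≡ f 0 + psum (f ∘ suc) b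
psum-suc f zero    = refl
psum-suc f (suc b) = trans (cong (_+ f (2 + b)) (psum-suc f b)) (+-assoc (f 0) _ _)

∑-psum : ∀ (f : ℕ → ℕ) b → ∑[ a ≤ b ] f (toℕ a) ≡ psum f b
∑-psum f zero    = +-identityʳ (f 0)
∑-psum f (suc b) = trans (cong (f 0 +_) (∑-psum (f ∘ suc) b)) (sym (psum-suc f b))

∑-reverse : ∀ (f : ℕ → ℕ) b → ∑[ a ≤ b ] f (b ∸ toℕ a) ≡ psum f b
∑-reverse f zero    = +-identityʳ (f 0)
∑-reverse f (suc b) = trans (cong (f (suc b) +_) (∑-reverse f b)) (+-comm (f (suc b)) (psum f b))

∑-truncate : ∀ k b (h : ℕ → ℕ) → b < k → ∑[ a < k ] (𝟙 (toℕ a ℕ.≤? b) * h (toℕ a)) ≡ ∑[ a ≤ b ] h (toℕ a)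
∑-truncate (suc k) zero    h _         = trans (cong (h 0 + 0 +_) (sum-replicate-zero k)) (+-identityʳ _)
∑-truncate (suc k) (suc b) h (s≤s b<k) =
  cong₂ _+_ (+-identityʳ (h 0))
            (trans (sum-cong-≗ {k} λ a → cong (_* h (suc (toℕ a))) (𝟙-s≤s (toℕ a) b)) (∑-truncate k b (h ∘ suc) b<k))

∑-pick : ∀ k lo (h : ℕ → ℕ) → lo < k → ∑[ a < k ] (𝟙 (lo ℕ.≟ toℕ a) * h (toℕ a)) ≡ h lo
∑-pick (suc k) zero     h _          = trans (cong (h 0 + 0 +_) (sum-replicate-zero k)) (trans (+-identityʳ _) (+-identityʳ _))
∑-pick (suc k) (suc lo) h (s≤s lo<k) = ∑-pick k lo (h ∘ suc) lo<k


-- Words with prescribed letter multiplicities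

total-updateAt-pred : ∀ {r} (q : Fin r → ℕ) i {k} → q i ≡ suc k → total r q ≡ suc (total r (updateAt q i pred))
total-updateAt-pred {suc r} q Fin.zero    qi≡1+k rewrite qi≡1+k = refl
total-updateAt-pred {suc r} q (Fin.suc i) qi≡1+k =
  trans (cong (q Fin.zero +_) (total-updateAt-pred (q ∘ Fin.suc) i qi≡1+k)) (+-suc (q Fin.zero) _)

total≡0⇒≡0 : ∀ {r} (q : Fin r → ℕ) → total r q ≡ 0 → ∀ i → q i ≡ 0
total≡0⇒≡0 {suc r} q total≡0 Fin.zero    = m+n≡0⇒m≡0 (q Fin.zero) total≡0
total≡0⇒≡0 {suc r} q total≡0 (Fin.suc i) = total≡0⇒≡0 (q ∘ Fin.suc) (m+n≡0⇒n≡0 (q Fin.zero) total≡0) i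

occ-∷-self : ∀ {r} (i : Fin r) w → occ i (i ∷ w) ≡ suc (occ i w)
occ-∷-self i w = cong length (filter-accept (Fin._≟ i) refl)

occ-∷-other : ∀ {r} {i j : Fin r} w → i ≢ j → occ j (i ∷ w) ≡ occ j w
occ-∷-other w i≢j = cong length (filter-reject (Fin._≟ _) i≢j)

IsRearrangement-∷ : ∀ {r} (q : Fin r → ℕ) i w →
                    IsRearrangement q (i ∷ w) ⇔ (NonZero (q i) × IsRearrangement (updateAt q i pred) w)
IsRearrangement-∷ q i w = mk⇔ to from
  where
  to : IsRearrangement q (i ∷ w) → NonZero (q i) × IsRearrangement (updateAt q i pred) w
  to occ≡q = subst NonZero qi≡1+occ _ , occ≡q-i
    where
    qi≡1+occ : suc (occ i w) ≡ q i
    qi≡1+occ = trans (sym (occ-∷-self i w)) (occ≡q i)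
    occ≡q-i : IsRearrangement (updateAt q i pred) w
    occ≡q-i j = pointwise (j Fin.≟ i)
      where
      pointwise : Dec (j ≡ i) → occ j w ≡ updateAt q i pred j
      pointwise (yes refl) = trans (cong pred qi≡1+occ) (sym (updateAt-updates i q))
      pointwise (no j≢i)   = trans (sym (occ-∷-other w (j≢i ∘ sym))) (trans (occ≡q j) (sym (updateAt-minimal j i q j≢i)))
  from : NonZero (q i) × IsRearrangement (updateAt q i pred) w → IsRearrangement q (i ∷ w)
  from (qi≢0 , occ≡q-i) j = pointwise (i Fin.≟ j)
    where
    pointwise : Dec (i ≡ j) → occ j (i ∷ w) ≡ q j
    pointwise (yes refl) = begin
      occ i (i ∷ w)    ≡⟨ occ-∷-self i w ⟩
      suc (occ i w)    ≡⟨ cong suc (trans (occ≡q-i i) (updateAt-updates i q)) ⟩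
      suc (pred (q i)) ≡⟨ suc-pred (q i) {{qi≢0}} ⟩
      q i              ∎
      where open ≡-Reasoning
    pointwise (no i≢j) = trans (occ-∷-other w i≢j) (trans (occ≡q-i j) (updateAt-minimal j i q (i≢j ∘ sym)))

∑-multiperms : ∀ {r} (q : Fin r → ℕ) (h : List (Fin r) → ℕ) →
               ∑[ π ← multiperms r q ] h π ≡ ∑[ w ← allWords r (total r q) ] (𝟙 (isRearrangement? q w) * h w)
∑-multiperms {r} q h = ∑-filter (isRearrangement? q) (allWords r (total r q)) h

module _ {r : ℕ} (q : Fin r → ℕ) where

  ∑-multiperms-nil : (h : List (Fin r) → ℕ) → total r q ≡ 0 → ∑[ π ← multiperms r q ] h π ≡ h []
  ∑-multiperms-nil h total≡0 = begin
    ∑[ π ← multiperms r q ] h π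
      ≡⟨ ∑-multiperms q h ⟩
    ∑[ w ← allWords r (total r q) ] (𝟙 (isRearrangement? q w) * h w)
      ≡⟨ cong (λ N → ∑[ w ← allWords r N ] (𝟙 (isRearrangement? q w) * h w)) total≡0 ⟩
    𝟙 (isRearrangement? q []) * h [] + 0
      ≡⟨ cong (λ c → c * h [] + 0) (𝟙-yes (isRearrangement? q []) λ i → sym (total≡0⇒≡0 q total≡0 i)) ⟩
    1 * h [] + 0
      ≡⟨ trans (+-identityʳ _) (*-identityˡ _) ⟩
    h [] ∎
    where open ≡-Reasoning

  -- The indicator is needed because pred 0 = 0: for q i = 0 the inner sum runs over multiperms r q.
  ∑-rearrangements-∷ : ∀ {N} (h : List (Fin r) → ℕ) → total r q ≡ suc N → ∀ i →
    ∑[ w ← allWords r N ] (𝟙 (isRearrangement? q (i ∷ w)) * h (i ∷ w))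
    ≡ 𝟙 (nonZero? (q i)) * ∑[ w ← multiperms r (updateAt q i pred) ] h (i ∷ w)
  ∑-rearrangements-∷ {N} h total≡1+N i = begin
    ∑[ w ← allWords r N ] (𝟙 (isRearrangement? q (i ∷ w)) * h (i ∷ w))
      ≡⟨ ∑-cong (allWords r N) (λ w → trans (cong (_* h (i ∷ w)) (split w)) (*-assoc (𝟙 (nonZero? (q i))) _ _)) ⟩
    ∑[ w ← allWords r N ] (𝟙 (nonZero? (q i)) * (𝟙 (isRearrangement? q₋ w) * h (i ∷ w)))
      ≡⟨ ∑-*ˡ (allWords r N) (𝟙 (nonZero? (q i))) (λ w → 𝟙 (isRearrangement? q₋ w) * h (i ∷ w)) ⟩
    𝟙 (nonZero? (q i)) * words-of N
      ≡⟨ restrict ⟩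
    𝟙 (nonZero? (q i)) * ∑[ w ← multiperms r q₋ ] h (i ∷ w) ∎
    where
    open ≡-Reasoning
    q₋ : Fin r → ℕ
    q₋ = updateAt q i pred

    split : ∀ w → 𝟙 (isRearrangement? q (i ∷ w)) ≡ 𝟙 (nonZero? (q i)) * 𝟙 (isRearrangement? q₋ w)
    split w = 𝟙-cong-× (IsRearrangement-∷ q i w) (isRearrangement? q (i ∷ w)) (nonZero? (q i)) (isRearrangement? q₋ w)

    words-of : ℕ → ℕ
    words-of M = ∑[ w ← allWords r M ] (𝟙 (isRearrangement? q₋ w) * h (i ∷ w))

    restrict : 𝟙 (nonZero? (q i)) * words-of N ≡ 𝟙 (nonZero? (q i)) * ∑[ w ← multiperms r q₋ ] h (i ∷ w)
    restrict with q i in qi≡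
    ... | zero  = refl
    ... | suc k = cong (1 *_) (trans (cong words-of N≡total) (sym (∑-multiperms q₋ (h ∘ (i ∷_)))))
      where
      N≡total : N ≡ total r q₋
      N≡total = suc-injective (trans (sym total≡1+N) (total-updateAt-pred q i qi≡))

  ∑-multiperms-cons : ∀ {N} (h : List (Fin r) → ℕ) → total r q ≡ suc N →
    ∑[ π ← multiperms r q ] h π
    ≡ ∑[ i < r ] (𝟙 (nonZero? (q i)) * ∑[ w ← multiperms r (updateAt q i pred) ] h (i ∷ w))
  ∑-multiperms-cons {N} h total≡1+N = begin
    ∑[ π ← multiperms r q ] h π
      ≡⟨ ∑-multiperms q h ⟩
    ∑[ w ← allWords r (total r q) ] (𝟙 (isRearrangement? q w) * h w)
      ≡⟨ cong (λ M → ∑[ w ← allWords r M ] (𝟙 (isRearrangement? q w) * h w)) total≡1+N ⟩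
    ∑[ w ← allWords r (suc N) ] (𝟙 (isRearrangement? q w) * h w)
      ≡⟨ ∑-concatMap (λ i → map (i ∷_) (allWords r N)) (allFin r) _ ⟩
    ∑[ i ← allFin r ] sumOver (map (i ∷_) (allWords r N)) (λ w → 𝟙 (isRearrangement? q w) * h w)
      ≡⟨ ∑-cong (allFin r) (λ i → trans (∑-map (i ∷_) (allWords r N) _) (∑-rearrangements-∷ h total≡1+N i)) ⟩
    ∑[ i ← allFin r ] (𝟙 (nonZero? (q i)) * ∑[ w ← multiperms r (updateAt q i pred) ] h (i ∷ w))
      ≡⟨ ∑-allFin r _ ⟩
    ∑[ i < r ] (𝟙 (nonZero? (q i)) * ∑[ w ← multiperms r (updateAt q i pred) ] h (i ∷ w)) ∎
    where open ≡-Reasoning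

∑-multiperms-cong-∷ : ∀ {r N} (q : Fin r → ℕ) {h g : List (Fin r) → ℕ} → total r q ≡ suc N →
                      (∀ j w → h (j ∷ w) ≡ g (j ∷ w)) → ∑[ π ← multiperms r q ] h π ≡ ∑[ π ← multiperms r q ] g π
∑-multiperms-cong-∷ {r} q {h} {g} total≡1+N h≡g = begin
  ∑[ π ← multiperms r q ] h π
    ≡⟨ ∑-multiperms-cons q h total≡1+N ⟩
  ∑[ j < r ] (𝟙 (nonZero? (q j)) * ∑[ w ← multiperms r (updateAt q j pred) ] h (j ∷ w))
    ≡⟨ sum-cong-≗ {r} (λ j → cong (𝟙 (nonZero? (q j)) *_) (∑-cong (multiperms r (updateAt q j pred)) (h≡g j))) ⟩
  ∑[ j < r ] (𝟙 (nonZero? (q j)) * ∑[ w ← multiperms r (updateAt q j pred) ] g (j ∷ w))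
    ≡⟨ ∑-multiperms-cons q g total≡1+N ⟨
  ∑[ π ← multiperms r q ] g π ∎
  where open ≡-Reasoning

-- desAfter i w is the number of descents of the word i w, where the letter i may also be r,
-- which exceeds every letter of Fin r.
desAfter : ∀ {r} → ℕ → List (Fin r) → ℕ
desAfter i []      = 0
desAfter i (a ∷ w) = 𝟙 (toℕ a ℕ.<? i) + desAfter (toℕ a) w

des-∷ : ∀ {r} (a : Fin r) w → des (a ∷ w) ≡ desAfter (toℕ a) w
des-∷ a []      = refl
des-∷ a (b ∷ w) = cong (𝟙 (toℕ b ℕ.<? toℕ a) +_) (des-∷ b w)

des≡desAfter0 : ∀ {r} (w : List (Fin r)) → des w ≡ desAfter 0 w
des≡desAfter0 []      = refl
des≡desAfter0 (a ∷ w) = des-∷ a w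

desAfter-top : ∀ {r} (a : Fin r) w → desAfter r (a ∷ w) ≡ suc (desAfter (toℕ a) w)
desAfter-top a w = cong (_+ desAfter (toℕ a) w) (𝟙-yes (toℕ a ℕ.<? _) (Finₚ.toℕ<n a))


-- MacMahon's identity

record MacMahonRecurrence {r : ℕ} (F : (Fin r → ℕ) → ℕ → ℕ → ℕ) : Set where
  field
    skip   : ∀ q t i → q i ≡ 0 → F q t (toℕ i) ≡ F q t (suc (toℕ i))
    remove : ∀ q t i {k} → q i ≡ suc k → F q t (toℕ i) ≡ F q t (suc (toℕ i)) + F (updateAt q i pred) t (toℕ i)
    wrap   : ∀ q t → F q (suc t) r ≡ F q t 0
    base   : ∀ q → F q 0 r ≡ 𝟙 (total r q ℕ.≟ 0)

module _ {r : ℕ} {F G : (Fin r → ℕ) → ℕ → ℕ → ℕ} (recF : MacMahonRecurrence F) (recG : MacMahonRecurrence G) where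
  private
    module F = MacMahonRecurrence recF
    module G = MacMahonRecurrence recG

    -- With d = r ∸ i the recursion is structural, lexicographically in (N, t, d).
    agree : ∀ N q → total r q ≡ N → ∀ t d i → d + i ≡ r → F q t i ≡ G q t i
    agree-at-letter : ∀ N q → total r q ≡ N → ∀ t d (j : Fin r) → suc d + toℕ j ≡ r → F q t (toℕ j) ≡ G q t (toℕ j)

    agree N q total≡N zero    zero    i refl = trans (F.base q) (sym (G.base q))
    agree N q total≡N (suc t) zero    i refl =
      trans (F.wrap q t) (trans (agree N q total≡N t r 0 (+-identityʳ r)) (sym (G.wrap q t)))
    agree N q total≡N t       (suc d) i d+i≡r =
      subst (λ i → F q t i ≡ G q t i) (Finₚ.toℕ-fromℕ< i<r)
            (agree-at-letter N q total≡N t d (Fin.fromℕ< i<r) (trans (cong (suc d +_) (Finₚ.toℕ-fromℕ< i<r)) d+i≡r))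
      where
      i<r : i < r
      i<r = subst (i <_) d+i≡r (s≤s (m≤n+m i d))

    agree-at-letter N q total≡N t d j d+j≡r with q j in qj≡
    ... | zero = begin
      F q t (toℕ j)       ≡⟨ F.skip q t j qj≡ ⟩
      F q t (suc (toℕ j)) ≡⟨ agree N q total≡N t d (suc (toℕ j)) (trans (+-suc d _) d+j≡r) ⟩
      G q t (suc (toℕ j)) ≡⟨ G.skip q t j qj≡ ⟨
      G q t (toℕ j)       ∎
      where open ≡-Reasoning
    agree-at-letter zero    q total≡0   t d j d+j≡r | suc k = contradiction (trans (sym qj≡) (total≡0⇒≡0 q total≡0 j)) λ ()
    agree-at-letter (suc N) q total≡1+N t d j d+j≡r | suc k = begin
      F q t (toℕ j)
        ≡⟨ F.remove q t j qj≡ ⟩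
      F q t (suc (toℕ j)) + F (updateAt q j pred) t (toℕ j)
        ≡⟨ cong₂ _+_ (agree (suc N) q total≡1+N t d (suc (toℕ j)) (trans (+-suc d _) d+j≡r))
                     (agree N (updateAt q j pred) total≡N t (suc d) (toℕ j) d+j≡r) ⟩
      G q t (suc (toℕ j)) + G (updateAt q j pred) t (toℕ j)
        ≡⟨ G.remove q t j qj≡ ⟨
      G q t (toℕ j) ∎
      where
      open ≡-Reasoning
      total≡N : total r (updateAt q j pred) ≡ N
      total≡N = suc-injective (trans (sym (total-updateAt-pred q j qj≡)) total≡1+N)

  MacMahonRecurrence-unique : ∀ q t {i} → i ≤ r → F q t i ≡ G q t i
  MacMahonRecurrence-unique q t {i} i≤r = agree (total r q) q refl t (r ∸ i) i (m∸n+n≡m i≤r)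

multichoose : ℕ → ℕ → ℕ
multichoose n       zero    = 1
multichoose zero    (suc k) = 0
multichoose (suc n) (suc k) = multichoose n (suc k) + multichoose (suc n) k

∏-multichoose-zero : ∀ r (q : Fin r → ℕ) → ∏[ j < r ] multichoose 0 (q j) ≡ 𝟙 (total r q ℕ.≟ 0)
∏-multichoose-zero zero    q = refl
∏-multichoose-zero (suc r) q with q Fin.zero
... | zero  = trans (+-identityʳ _) (∏-multichoose-zero r (q ∘ Fin.suc))
... | suc k = refl

module _ {r : ℕ} where

  multichooseProduct : (Fin r → ℕ) → ℕ → ℕ → ℕ
  multichooseProduct q t i = ∏[ j < r ] multichoose (𝟙 (i ℕ.≤? toℕ j) + t) (q j)

  multichooseProduct-recurrence : MacMahonRecurrence multichooseProduct
  multichooseProduct-recurrence = record { skip = skip ; remove = remove ; wrap = wrap ; base = base }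
    where
    factor : (Fin r → ℕ) → ℕ → ℕ → Fin r → ℕ
    factor q t i j = multichoose (𝟙 (i ℕ.≤? toℕ j) + t) (q j)

    off-letter : ∀ q t i j → j ≢ i → factor q t (toℕ i) j ≡ factor q t (suc (toℕ i)) j
    off-letter q t i j j≢i = cong (λ b → multichoose (b + t) (q j)) (𝟙-≤-≢ (j≢i ∘ sym ∘ Finₚ.toℕ-injective))

    above-all-letters : ∀ q t → (λ j → factor q t r j) ≗ (λ j → multichoose t (q j))
    above-all-letters q t j = cong (λ b → multichoose (b + t) (q j)) (𝟙-no (r ℕ.≤? toℕ j) (<⇒≱ (Finₚ.toℕ<n j)))

    skip : ∀ q t i → q i ≡ 0 → multichooseProduct q t (toℕ i) ≡ multichooseProduct q t (suc (toℕ i))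
    skip q t i qi≡0 = ∏-cong r λ j → at j (j Fin.≟ i)
      where
      at : ∀ j → Dec (j ≡ i) → factor q t (toℕ i) j ≡ factor q t (suc (toℕ i)) j
      at j (yes refl) rewrite qi≡0 = refl
      at j (no j≢i)   = off-letter q t i j j≢i

    remove : ∀ q t i {k} → q i ≡ suc k →
             multichooseProduct q t (toℕ i)
             ≡ multichooseProduct q t (suc (toℕ i)) + multichooseProduct (updateAt q i pred) t (toℕ i)
    remove q t i {k} qi≡1+k = ∏-multilinear i _ _ _ (off-letter q t i) unchanged at-i
      where
      unchanged : ∀ j → j ≢ i → factor q t (toℕ i) j ≡ factor (updateAt q i pred) t (toℕ i) j
      unchanged j j≢i = cong (multichoose _) (sym (updateAt-minimal j i q j≢i))
      at-i : factor q t (toℕ i) i ≡ factor q t (suc (toℕ i)) i + factor (updateAt q i pred) t (toℕ i) i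
      at-i rewrite 𝟙-yes (toℕ i ℕ.≤? toℕ i) ≤-refl | 𝟙-no (suc (toℕ i) ℕ.≤? toℕ i) (n≮n (toℕ i))
                 | updateAt-updates i {pred} q | qi≡1+k = refl

    wrap : ∀ q t → multichooseProduct q (suc t) r ≡ multichooseProduct q t 0
    wrap q t = ∏-cong r (above-all-letters q (suc t))

    base : ∀ q → multichooseProduct q 0 r ≡ 𝟙 (total r q ℕ.≟ 0)
    base q = trans (∏-cong r (above-all-letters q 0)) (∏-multichoose-zero r q)

module _ {r : ℕ} where

  descentSum : (Fin r → ℕ) → ℕ → ℕ → ℕ
  descentSum q t i = ∑[ π ← multiperms r q ] psum^ (suc (total r q)) (monomial (desAfter i π)) t

  descentSum-first-letter : ∀ q t i {k} → q i ≡ suc k →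
    ∑[ w ← multiperms r (updateAt q i pred) ] psum^ (suc (total r q)) (monomial (desAfter (toℕ i) (i ∷ w))) t
    ≡ ∑[ w ← multiperms r (updateAt q i pred) ] psum^ (suc (total r q)) (monomial (desAfter (suc (toℕ i)) (i ∷ w))) t
      + descentSum (updateAt q i pred) t (toℕ i)
  descentSum-first-letter q t i qi≡1+k = begin
    ∑[ w ← ws ] f (toℕ i) w                               ≡⟨ ∑-cong ws split ⟩
    ∑[ w ← ws ] (f (suc (toℕ i)) w + g (total r q) w)     ≡⟨ ∑-distrib-+ ws (f (suc (toℕ i))) (g (total r q)) ⟩
    ∑[ w ← ws ] f (suc (toℕ i)) w + ∑[ w ← ws ] g (total r q) w
      ≡⟨ cong (λ T → ∑[ w ← ws ] f (suc (toℕ i)) w + ∑[ w ← ws ] g T w) (total-updateAt-pred q i qi≡1+k) ⟩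
    ∑[ w ← ws ] f (suc (toℕ i)) w + descentSum (updateAt q i pred) t (toℕ i) ∎
    where
    open ≡-Reasoning
    K : ℕ
    K = suc (total r q)
    ws : List (List (Fin r))
    ws = multiperms r (updateAt q i pred)
    f : ℕ → List (Fin r) → ℕ
    f b w = psum^ K (monomial (desAfter b (i ∷ w))) t
    g : ℕ → List (Fin r) → ℕ
    g T w = psum^ T (monomial (desAfter (toℕ i) w)) t
    split : ∀ w → f (toℕ i) w ≡ f (suc (toℕ i)) w + g (total r q) w
    split w = begin
      psum^ K (monomial (𝟙 (toℕ i ℕ.<? toℕ i) + desAfter (toℕ i) w)) t
        ≡⟨ cong (λ b → psum^ K (monomial (b + desAfter (toℕ i) w)) t) (𝟙-no (toℕ i ℕ.<? toℕ i) (n≮n (toℕ i))) ⟩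
      psum^ K (monomial (desAfter (toℕ i) w)) t
        ≡⟨ psum^-monomial-unfold (total r q) (desAfter (toℕ i) w) t ⟩
      psum^ K (monomial (suc (desAfter (toℕ i) w))) t + g (total r q) w
        ≡⟨ cong (λ b → psum^ K (monomial (b + desAfter (toℕ i) w)) t + g (total r q) w)
                (𝟙-yes (toℕ i ℕ.<? suc (toℕ i)) ≤-refl) ⟨
      f (suc (toℕ i)) w + g (total r q) w ∎

  descentSum-step : ∀ {N} q → total r q ≡ suc N → ∀ t (i : Fin r) →
    descentSum q t (toℕ i)
    ≡ descentSum q t (suc (toℕ i)) + 𝟙 (nonZero? (q i)) * descentSum (updateAt q i pred) t (toℕ i)
  descentSum-step q total≡1+N t i = begin
    descentSum q t (toℕ i)                        ≡⟨ ∑-multiperms-cons q _ total≡1+N ⟩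
    ∑[ j < r ] term (toℕ i) j                     ≡⟨ ∑-update i (term (toℕ i)) (term (suc (toℕ i))) _ off-letter at-letter ⟩
    ∑[ j < r ] term (suc (toℕ i)) j + removed     ≡⟨ cong (_+ removed) (∑-multiperms-cons q _ total≡1+N) ⟨
    descentSum q t (suc (toℕ i)) + removed        ∎
    where
    open ≡-Reasoning
    removed : ℕ
    removed = 𝟙 (nonZero? (q i)) * descentSum (updateAt q i pred) t (toℕ i)
    term : ℕ → Fin r → ℕ
    term i j = 𝟙 (nonZero? (q j)) * ∑[ w ← multiperms r (updateAt q j pred) ] psum^ (suc (total r q)) (monomial (desAfter i (j ∷ w))) t

    off-letter : ∀ j → j ≢ i → term (toℕ i) j ≡ term (suc (toℕ i)) j
    off-letter j j≢i = cong (𝟙 (nonZero? (q j)) *_) (∑-cong (multiperms r (updateAt q j pred)) λ w →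
      cong (λ b → psum^ (suc (total r q)) (monomial (b + desAfter (toℕ j) w)) t)
           (trans (sym (𝟙-≤-≢ (j≢i ∘ Finₚ.toℕ-injective))) (sym (𝟙-s≤s (toℕ j) (toℕ i)))))

    at-letter : term (toℕ i) i ≡ term (suc (toℕ i)) i + removed
    at-letter with q i in qi≡
    ... | zero  = refl
    ... | suc k = trans (cong (1 *_) (descentSum-first-letter q t i qi≡))
                        (*-distribˡ-+ 1 (after-i (suc (toℕ i))) (descentSum (updateAt q i pred) t (toℕ i)))
      where
      after-i : ℕ → ℕ
      after-i b = ∑[ w ← multiperms r (updateAt q i pred) ] psum^ (suc (total r q)) (monomial (desAfter b (i ∷ w))) t

  descentSum-wrap : ∀ q t → descentSum q (suc t) r ≡ descentSum q t 0
  descentSum-wrap q t = by-total (total r q) refl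
    where
    by-total : ∀ N → total r q ≡ N → descentSum q (suc t) r ≡ descentSum q t 0
    by-total zero    total≡0   = begin
      descentSum q (suc t) r                               ≡⟨ ∑-multiperms-nil q _ total≡0 ⟩
      psum^ (suc (total r q)) (monomial 0) (suc t)         ≡⟨ cong (λ T → psum^ (suc T) (monomial 0) (suc t)) total≡0 ⟩
      psum (monomial 0) (suc t)                            ≡⟨ trans (psum-monomial-zero (suc t)) (sym (psum-monomial-zero t)) ⟩
      psum (monomial 0) t                                  ≡⟨ cong (λ T → psum^ (suc T) (monomial 0) t) total≡0 ⟨
      psum^ (suc (total r q)) (monomial 0) t               ≡⟨ ∑-multiperms-nil q _ total≡0 ⟨
      descentSum q t 0                                     ∎
      where open ≡-Reasoning
    by-total (suc N) total≡1+N = ∑-multiperms-cong-∷ q total≡1+N λ j w →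
      trans (cong (λ d → psum^ (suc (total r q)) (monomial d) (suc t)) (desAfter-top j w))
            (psum^-monomial-suc (suc (total r q)) (desAfter (toℕ j) w) (suc t))

  descentSum-base : ∀ q → descentSum q 0 r ≡ 𝟙 (total r q ℕ.≟ 0)
  descentSum-base q = by-total (total r q) refl
    where
    by-total : ∀ N → total r q ≡ N → descentSum q 0 r ≡ 𝟙 (total r q ℕ.≟ 0)
    by-total zero    total≡0   = trans (∑-multiperms-nil q _ total≡0)
      (trans (psum^-zero (suc (total r q)) (monomial 0)) (cong (λ T → 𝟙 (T ℕ.≟ 0)) (sym total≡0)))
    by-total (suc N) total≡1+N = trans (∑-multiperms-cong-∷ q {g = λ _ → 0} total≡1+N vanishes)
      (trans (∑-zero (multiperms r q)) (cong (λ T → 𝟙 (T ℕ.≟ 0)) (sym total≡1+N)))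
      where
      vanishes : ∀ j w → psum^ (suc (total r q)) (monomial (desAfter r (j ∷ w))) 0 ≡ 0
      vanishes j w = trans (cong (λ d → psum^ (suc (total r q)) (monomial d) 0) (desAfter-top j w))
                           (psum^-monomial-suc (suc (total r q)) (desAfter (toℕ j) w) 0)

  descentSum-recurrence : MacMahonRecurrence descentSum
  descentSum-recurrence = record { skip = skip ; remove = remove ; wrap = descentSum-wrap ; base = descentSum-base }
    where
    skip : ∀ q t i → q i ≡ 0 → descentSum q t (toℕ i) ≡ descentSum q t (suc (toℕ i))
    skip q t i qi≡0 = by-total (total r q) refl
      where
      by-total : ∀ N → total r q ≡ N → descentSum q t (toℕ i) ≡ descentSum q t (suc (toℕ i))
      by-total zero    total≡0   = trans (∑-multiperms-nil q _ total≡0) (sym (∑-multiperms-nil q _ total≡0))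
      by-total (suc N) total≡1+N = trans (descentSum-step q total≡1+N t i)
        (trans (cong (λ m → descentSum q t (suc (toℕ i)) + 𝟙 (nonZero? m) * descentSum (updateAt q i pred) t (toℕ i)) qi≡0)
               (+-identityʳ _))

    remove : ∀ q t i {k} → q i ≡ suc k →
             descentSum q t (toℕ i) ≡ descentSum q t (suc (toℕ i)) + descentSum (updateAt q i pred) t (toℕ i)
    remove q t i qi≡1+k = trans (descentSum-step q (total-updateAt-pred q i qi≡1+k) t i)
      (cong (descentSum q t (suc (toℕ i)) +_)
            (trans (cong (λ m → 𝟙 (nonZero? m) * descentSum (updateAt q i pred) t (toℕ i)) qi≡1+k) (*-identityˡ _)))

descentCount : ∀ r → (Fin r → ℕ) → ℕ → ℕ
descentCount r q d = ∑[ π ← multiperms r q ] monomial (des π) d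

macMahonsIdentity : ∀ {r} (q : Fin r → ℕ) t → ∏[ j < r ] multichoose (suc t) (q j) ≡ psum^ (suc (total r q)) (descentCount r q) t
macMahonsIdentity {r} q t = begin
  multichooseProduct q t 0
    ≡⟨ MacMahonRecurrence-unique multichooseProduct-recurrence descentSum-recurrence q t z≤n ⟩
  descentSum q t 0
    ≡⟨ ∑-cong (multiperms r q) (λ π → cong (λ d → psum^ (suc (total r q)) (monomial d) t) (sym (des≡desAfter0 π))) ⟩
  ∑[ π ← multiperms r q ] psum^ (suc (total r q)) (monomial (des π)) t
    ≡⟨ psum^-∑ (suc (total r q)) (multiperms r q) (monomial ∘ des) t ⟨
  psum^ (suc (total r q)) (descentCount r q) t ∎
  where open ≡-Reasoning


-- Lattice points of dilated order polytopes

module _ (n : ℕ) where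

  Point : ℕ → Set
  Point m = Fin m → Fin (suc n)

  sumPoints : (m : ℕ) → (Point m → ℕ) → ℕ
  sumPoints m h = ∑[ x ← allFuns m (suc n) ] h x

  Extensional : ∀ {m} → (Point m → ℕ) → Set
  Extensional h = ∀ {x y} → x ≗ y → h x ≡ h y

  sumPoints-cong : ∀ m {g h : Point m → ℕ} → (∀ x → g x ≡ h x) → sumPoints m g ≡ sumPoints m h
  sumPoints-cong m = ∑-cong (allFuns m (suc n))

  sumPoints-∷ : ∀ m (h : Point (suc m) → ℕ) → sumPoints (suc m) h ≡ ∑[ a ← allFin (suc n) ] sumPoints m (λ x → h (a VF.∷ x))
  sumPoints-∷ m h = trans (∑-concatMap (λ a → map (a VF.∷_) (allFuns m (suc n))) (allFin (suc n)) h)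
                          (∑-cong (allFin (suc n)) λ a → ∑-map (a VF.∷_) (allFuns m (suc n)) h)

  sumPoints-1 : ∀ (h : Point 1 → ℕ) → Extensional h → sumPoints 1 h ≡ ∑[ a ← allFin (suc n) ] h (λ _ → a)
  sumPoints-1 h h-ext = trans (sumPoints-∷ 0 h) (∑-cong (allFin (suc n)) λ a → trans (+-identityʳ _) (h-ext λ { Fin.zero → refl }))

  sumPoints-++ : ∀ m₁ m₂ (h : Point (m₁ + m₂) → ℕ) → Extensional h →
                 sumPoints (m₁ + m₂) h ≡ sumPoints m₁ (λ y → sumPoints m₂ (λ z → h (y VF.++ z)))
  sumPoints-++ zero     m₂ h h-ext = sym (+-identityʳ _)
  sumPoints-++ (suc m₁) m₂ h h-ext = begin
    sumPoints (suc (m₁ + m₂)) h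
      ≡⟨ sumPoints-∷ (m₁ + m₂) h ⟩
    ∑[ a ← allFin (suc n) ] sumPoints (m₁ + m₂) (λ x → h (a VF.∷ x))
      ≡⟨ ∑-cong (allFin (suc n)) (λ a → sumPoints-++ m₁ m₂ (λ x → h (a VF.∷ x)) (h-ext ∘ ∷-cong a)) ⟩
    ∑[ a ← allFin (suc n) ] sumPoints m₁ (λ y → sumPoints m₂ (λ z → h (a VF.∷ (y VF.++ z))))
      ≡⟨ ∑-cong (allFin (suc n)) (λ a → sumPoints-cong m₁ λ y → sumPoints-cong m₂ λ z → h-ext (∷-++ a y z)) ⟩
    ∑[ a ← allFin (suc n) ] sumPoints m₁ (λ y → sumPoints m₂ (λ z → h ((a VF.∷ y) VF.++ z)))
      ≡⟨ sumPoints-∷ m₁ _ ⟨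
    sumPoints (suc m₁) (λ y → sumPoints m₂ (λ z → h (y VF.++ z))) ∎
    where
    open ≡-Reasoning
    ∷-cong : ∀ {m} a {x y : Point m} → x ≗ y → (a VF.∷ x) ≗ (a VF.∷ y)
    ∷-cong a x≗y Fin.zero    = refl
    ∷-cong a x≗y (Fin.suc i) = x≗y i
    ∷-++ : ∀ a (y : Point m₁) (z : Point m₂) → (a VF.∷ (y VF.++ z)) ≗ ((a VF.∷ y) VF.++ z)
    ∷-++ a y z Fin.zero    = refl
    ∷-++ a y z (Fin.suc i) with splitAt m₁ i
    ... | inj₁ _ = refl
    ... | inj₂ _ = refl

  sumPoints-* : ∀ m₁ m₂ (f : Point m₁ → ℕ) (g : Point m₂ → ℕ) →
                sumPoints m₁ (λ y → sumPoints m₂ (λ z → f y * g z)) ≡ sumPoints m₁ f * sumPoints m₂ g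
  sumPoints-* m₁ m₂ f g = trans (sumPoints-cong m₁ λ y → ∑-*ˡ (allFuns m₂ (suc n)) (f y) g)
                                (∑-*ʳ (allFuns m₁ (suc n)) (sumPoints m₂ g) f)

  Monotone : ∀ {A : Set} → (A → A → Set) → (A → Fin (suc n)) → Set
  Monotone R x = ∀ a b → R a b → toℕ (x a) ≤ toℕ (x b)

  Monotone-splitAt : ∀ {m₁ m₂} (R : Fin m₁ ⊎ Fin m₂ → Fin m₁ ⊎ Fin m₂ → Set) (y : Point m₁) (z : Point m₂) →
                     Monotone (λ i j → R (splitAt m₁ i) (splitAt m₁ j)) (y VF.++ z) ⇔ Monotone R [ y , z ]
  Monotone-splitAt {m₁} {m₂} R y z = mk⇔ to (λ mono i j → mono (splitAt m₁ i) (splitAt m₁ j))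
    where
    to : Monotone (λ i j → R (splitAt m₁ i) (splitAt m₁ j)) (y VF.++ z) → Monotone R [ y , z ]
    to mono a b = subst₂ (λ a b → R a b → toℕ ([ y , z ] a) ≤ toℕ ([ y , z ] b))
                         (Finₚ.splitAt-join m₁ m₂ a) (Finₚ.splitAt-join m₁ m₂ b) (mono (join m₁ m₂ a) (join m₁ m₂ b))

  module _ (P Q : FinPoset) (y : Point (size P)) (z : Point (size Q)) where

    InDilated-+P : InDilatedOrderPolytope (P +P Q) n (y VF.++ z) ⇔ (InDilatedOrderPolytope P n y × InDilatedOrderPolytope Q n z)
    InDilated-+P = ⇔-trans (Monotone-splitAt (sumRel P Q) y z) (mk⇔ to from)
      where
      to : Monotone (sumRel P Q) [ y , z ] → InDilatedOrderPolytope P n y × InDilatedOrderPolytope Q n z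
      to mono = (λ i j → mono (inj₁ i) (inj₁ j)) , (λ i j → mono (inj₂ i) (inj₂ j))
      from : InDilatedOrderPolytope P n y × InDilatedOrderPolytope Q n z → Monotone (sumRel P Q) [ y , z ]
      from (monoP , monoQ) (inj₁ i) (inj₁ j) = monoP i j
      from (monoP , monoQ) (inj₂ i) (inj₂ j) = monoQ i j

    InDilated-⊕P : InDilatedOrderPolytope (P ⊕P Q) n (y VF.++ z)
                   ⇔ (InDilatedOrderPolytope P n y × InDilatedOrderPolytope Q n z × (∀ i j → toℕ (y i) ≤ toℕ (z j)))
    InDilated-⊕P = ⇔-trans (Monotone-splitAt (ordRel P Q) y z) (mk⇔ to from)
      where
      to : Monotone (ordRel P Q) [ y , z ] → _
      to mono = (λ i j → mono (inj₁ i) (inj₁ j)) , (λ i j → mono (inj₂ i) (inj₂ j)) , (λ i j → mono (inj₁ i) (inj₂ j) _)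
      from : InDilatedOrderPolytope P n y × InDilatedOrderPolytope Q n z × (∀ i j → toℕ (y i) ≤ toℕ (z j)) →
             Monotone (ordRel P Q) [ y , z ]
      from (monoP , monoQ , y≤z) (inj₁ i) (inj₁ j) = monoP i j
      from (monoP , monoQ , y≤z) (inj₂ i) (inj₂ j) = monoQ i j
      from (monoP , monoQ , y≤z) (inj₁ i) (inj₂ j) = λ _ → y≤z i j

  Bounded : ∀ {m} → ℕ → ℕ → Point m → Set
  Bounded lo hi x = ∀ i → lo ≤ toℕ (x i) × toℕ (x i) ≤ hi

  bounded? : ∀ {m} lo hi → U.Decidable (Bounded {m} lo hi)
  bounded? lo hi x = Finₚ.all? λ i → (lo ℕ.≤? toℕ (x i)) ×-dec (toℕ (x i) ℕ.≤? hi)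

  Admissible : (P : FinPoset) → ℕ → ℕ → Point (size P) → Set
  Admissible P lo hi x = InDilatedOrderPolytope P n x × Bounded lo hi x

  admissible? : ∀ P lo hi → U.Decidable (Admissible P lo hi)
  admissible? P lo hi x = inDilated? P n x ×-dec bounded? lo hi x

  countBetween : FinPoset → ℕ → ℕ → ℕ
  countBetween P lo hi = sumPoints (size P) (𝟙 ∘ admissible? P lo hi)

  InDilated-≗ : ∀ P {x y : Point (size P)} → x ≗ y → InDilatedOrderPolytope P n x → InDilatedOrderPolytope P n y
  InDilated-≗ P x≗y mono i j i≺j = subst₂ (λ a b → toℕ a ≤ toℕ b) (x≗y i) (x≗y j) (mono i j i≺j)

  Bounded-≗ : ∀ {m} lo hi {x y : Point m} → x ≗ y → Bounded lo hi x → Bounded lo hi y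
  Bounded-≗ lo hi x≗y bnd i = subst (λ a → lo ≤ toℕ a × toℕ a ≤ hi) (x≗y i) (bnd i)

  inDilated-extensional : ∀ P → Extensional (𝟙 ∘ inDilated? P n)
  inDilated-extensional P {x} {y} x≗y =
    𝟙-cong (mk⇔ (InDilated-≗ P x≗y) (InDilated-≗ P (sym ∘ x≗y))) (inDilated? P n x) (inDilated? P n y)

  admissible-extensional : ∀ P lo hi → Extensional (𝟙 ∘ admissible? P lo hi)
  admissible-extensional P lo hi {x} {y} x≗y =
    𝟙-cong (mk⇔ (λ (mono , bnd) → InDilated-≗ P x≗y mono , Bounded-≗ lo hi x≗y bnd)
                (λ (mono , bnd) → InDilated-≗ P (sym ∘ x≗y) mono , Bounded-≗ lo hi (sym ∘ x≗y) bnd))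
           (admissible? P lo hi x) (admissible? P lo hi y)

  Bounded-++ : ∀ {m₁ m₂} lo hi (y : Point m₁) (z : Point m₂) → Bounded lo hi (y VF.++ z) ⇔ (Bounded lo hi y × Bounded lo hi z)
  Bounded-++ {m₁} {m₂} lo hi y z = mk⇔ to from
    where
    InRange : Fin m₁ ⊎ Fin m₂ → Set
    InRange a = lo ≤ toℕ ([ y , z ] a) × toℕ ([ y , z ] a) ≤ hi
    to : Bounded lo hi (y VF.++ z) → Bounded lo hi y × Bounded lo hi z
    to bnd = (λ i → subst InRange (Finₚ.splitAt-join m₁ m₂ (inj₁ i)) (bnd (join m₁ m₂ (inj₁ i))))
           , (λ i → subst InRange (Finₚ.splitAt-join m₁ m₂ (inj₂ i)) (bnd (join m₁ m₂ (inj₂ i))))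
    from : Bounded lo hi y × Bounded lo hi z → Bounded lo hi (y VF.++ z)
    from (bndY , bndZ) i with splitAt m₁ i
    ... | inj₁ j = bndY j
    ... | inj₂ j = bndZ j

  countBetween-+P : ∀ P Q lo hi → countBetween (P +P Q) lo hi ≡ countBetween P lo hi * countBetween Q lo hi
  countBetween-+P P Q lo hi = begin
    countBetween (P +P Q) lo hi
      ≡⟨ sumPoints-++ (size P) (size Q) _ (admissible-extensional (P +P Q) lo hi) ⟩
    sumPoints (size P) (λ y → sumPoints (size Q) (λ z → 𝟙 (admissible? (P +P Q) lo hi (y VF.++ z))))
      ≡⟨ sumPoints-cong (size P) (λ y → sumPoints-cong (size Q) λ z → factor y z) ⟩
    sumPoints (size P) (λ y → sumPoints (size Q) (λ z → 𝟙 (admissible? P lo hi y) * 𝟙 (admissible? Q lo hi z)))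
      ≡⟨ sumPoints-* (size P) (size Q) (𝟙 ∘ admissible? P lo hi) (𝟙 ∘ admissible? Q lo hi) ⟩
    countBetween P lo hi * countBetween Q lo hi ∎
    where
    open ≡-Reasoning
    Admissible-+P : ∀ y z → Admissible (P +P Q) lo hi (y VF.++ z) ⇔ (Admissible P lo hi y × Admissible Q lo hi z)
    Admissible-+P y z = mk⇔
      (λ (mono , bnd) → let (monoY , monoZ) = Equivalence.to (InDilated-+P P Q y z) mono
                            (bndY , bndZ)   = Equivalence.to (Bounded-++ lo hi y z) bnd
                        in (monoY , bndY) , (monoZ , bndZ))
      (λ ((monoY , bndY) , (monoZ , bndZ)) → Equivalence.from (InDilated-+P P Q y z) (monoY , monoZ)
                                           , Equivalence.from (Bounded-++ lo hi y z) (bndY , bndZ))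
    factor : ∀ y z → 𝟙 (admissible? (P +P Q) lo hi (y VF.++ z)) ≡ 𝟙 (admissible? P lo hi y) * 𝟙 (admissible? Q lo hi z)
    factor y z = 𝟙-cong-× (Admissible-+P y z) (admissible? (P +P Q) lo hi (y VF.++ z))
                          (admissible? P lo hi y) (admissible? Q lo hi z)

  countBetween-size-0 : ∀ (R : Fin 0 → Fin 0 → Set) (R? : Decidable R) lo hi →
                        countBetween (record { size = 0 ; _≺_ = R ; _≺?_ = R? }) lo hi ≡ 1
  countBetween-size-0 R R? lo hi = cong (_+ 0) (𝟙-yes (admissible? P lo hi (λ ())) ((λ ()) , (λ ())))
    where
    P : FinPoset
    P = record { size = 0 ; _≺_ = R ; _≺?_ = R? }

  countBetween-sumChains : ∀ r (p : Fin r → ℕ) lo hi →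
                           countBetween (sumChains r p) lo hi ≡ ∏[ j < r ] countBetween (chain (p j)) lo hi
  countBetween-sumChains zero    p lo hi = countBetween-size-0 (_≺_ emptyP) (_≺?_ emptyP) lo hi
  countBetween-sumChains (suc r) p lo hi =
    trans (countBetween-+P (chain (p Fin.zero)) (sumChains r (p ∘ Fin.suc)) lo hi)
          (cong (countBetween (chain (p Fin.zero)) lo hi *_) (countBetween-sumChains r (p ∘ Fin.suc) lo hi))

  Admissible-chain-∷ : ∀ {k} lo hi a (x : Point k) →
    Admissible (chain (suc k)) lo hi (a VF.∷ x) ⇔ ((lo ≤ toℕ a × toℕ a ≤ hi) × Admissible (chain k) (toℕ a) hi x)
  Admissible-chain-∷ lo hi a x = mk⇔ to from
    where
    to : Admissible (chain (suc _)) lo hi (a VF.∷ x) → _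
    to (mono , bnd) = bnd Fin.zero
                    , (λ i j i<j → mono (Fin.suc i) (Fin.suc j) (s≤s i<j))
                    , (λ j → mono Fin.zero (Fin.suc j) (s≤s z≤n) , proj₂ (bnd (Fin.suc j)))
    from : (lo ≤ toℕ a × toℕ a ≤ hi) × Admissible (chain _) (toℕ a) hi x → Admissible (chain (suc _)) lo hi (a VF.∷ x)
    from ((lo≤a , a≤hi) , monoX , bndX) = mono , bnd
      where
      mono : InDilatedOrderPolytope (chain (suc _)) n (a VF.∷ x)
      mono Fin.zero    (Fin.suc j) _         = proj₁ (bndX j)
      mono (Fin.suc i) (Fin.suc j) (s≤s i<j) = monoX i j i<j
      bnd : Bounded lo hi (a VF.∷ x)
      bnd Fin.zero    = lo≤a , a≤hi
      bnd (Fin.suc j) = ≤-trans lo≤a (proj₁ (bndX j)) , proj₂ (bndX j)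

  between : ℕ → ℕ → ℕ → ℕ
  between lo hi a = 𝟙 (lo ℕ.≤? a) * 𝟙 (a ℕ.≤? hi)

  between-split : ∀ {lo hi} a → lo ≤ hi → between lo hi a ≡ between (suc lo) hi a + 𝟙 (lo ℕ.≟ a)
  between-split {lo} {hi} a lo≤hi = begin
    𝟙 (lo ℕ.≤? a) * 𝟙 (a ℕ.≤? hi)                               ≡⟨ cong (_* 𝟙 (a ℕ.≤? hi)) (𝟙-≤-split lo a) ⟩
    (𝟙 (suc lo ℕ.≤? a) + 𝟙 (lo ℕ.≟ a)) * 𝟙 (a ℕ.≤? hi)         ≡⟨ *-distribʳ-+ (𝟙 (a ℕ.≤? hi)) (𝟙 (suc lo ℕ.≤? a)) _ ⟩
    between (suc lo) hi a + 𝟙 (lo ℕ.≟ a) * 𝟙 (a ℕ.≤? hi)        ≡⟨ cong (between (suc lo) hi a +_) below-hi ⟩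
    between (suc lo) hi a + 𝟙 (lo ℕ.≟ a)                        ∎
    where
    open ≡-Reasoning
    below-hi : 𝟙 (lo ℕ.≟ a) * 𝟙 (a ℕ.≤? hi) ≡ 𝟙 (lo ℕ.≟ a)
    below-hi = 𝟙-*-implied (λ { refl → lo≤hi }) (lo ℕ.≟ a) (a ℕ.≤? hi)

  countBetween-chain-suc : ∀ k lo hi →
    countBetween (chain (suc k)) lo hi ≡ ∑[ a ≤ n ] (between lo hi (toℕ a) * countBetween (chain k) (toℕ a) hi)
  countBetween-chain-suc k lo hi = begin
    countBetween (chain (suc k)) lo hi
      ≡⟨ sumPoints-∷ k _ ⟩
    ∑[ a ← allFin (suc n) ] sumPoints k (λ x → 𝟙 (admissible? (chain (suc k)) lo hi (a VF.∷ x)))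
      ≡⟨ ∑-cong (allFin (suc n)) (λ a → trans (sumPoints-cong k (first-value a))
                                               (∑-*ˡ (allFuns k (suc n)) (between lo hi (toℕ a)) (𝟙 ∘ admissible? (chain k) (toℕ a) hi))) ⟩
    ∑[ a ← allFin (suc n) ] (between lo hi (toℕ a) * countBetween (chain k) (toℕ a) hi)
      ≡⟨ ∑-allFin (suc n) _ ⟩
    ∑[ a ≤ n ] (between lo hi (toℕ a) * countBetween (chain k) (toℕ a) hi) ∎
    where
    open ≡-Reasoning
    first-value : ∀ a x → 𝟙 (admissible? (chain (suc k)) lo hi (a VF.∷ x))
                          ≡ between lo hi (toℕ a) * 𝟙 (admissible? (chain k) (toℕ a) hi x)
    first-value a x =
      trans (𝟙-cong-× (Admissible-chain-∷ lo hi a x) (admissible? (chain (suc k)) lo hi (a VF.∷ x))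
                      ((lo ℕ.≤? toℕ a) ×-dec (toℕ a ℕ.≤? hi)) (admissible? (chain k) (toℕ a) hi x))
            (cong (_* 𝟙 (admissible? (chain k) (toℕ a) hi x)) (𝟙-× (lo ℕ.≤? toℕ a) (toℕ a ℕ.≤? hi)))

  countBetween-chain-empty : ∀ k hi → countBetween (chain (suc k)) (suc hi) hi ≡ 0
  countBetween-chain-empty k hi = trans (countBetween-chain-suc k (suc hi) hi)
    (trans (sum-cong-≗ {suc n} λ a → cong (_* countBetween (chain k) (toℕ a) hi) (empty (toℕ a)))
           (sum-replicate-zero (suc n)))
    where
    empty : ∀ a → between (suc hi) hi a ≡ 0
    empty a = 𝟙-*-exclusive <⇒≱ (suc hi ℕ.≤? a) (a ℕ.≤? hi)

  countBetween-chain-step : ∀ k lo hi → lo ≤ hi → hi ≤ n →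
    countBetween (chain (suc k)) lo hi ≡ countBetween (chain (suc k)) (suc lo) hi + countBetween (chain k) lo hi
  countBetween-chain-step k lo hi lo≤hi hi≤n = begin
    countBetween (chain (suc k)) lo hi
      ≡⟨ countBetween-chain-suc k lo hi ⟩
    ∑[ a ≤ n ] (between lo hi (toℕ a) * C (toℕ a))
      ≡⟨ sum-cong-≗ {suc n} (λ a → split (toℕ a)) ⟩
    ∑[ a ≤ n ] (between (suc lo) hi (toℕ a) * C (toℕ a) + 𝟙 (lo ℕ.≟ toℕ a) * C (toℕ a))
      ≡⟨ FinSum.∑-distrib-+ {suc n} (λ a → between (suc lo) hi (toℕ a) * C (toℕ a)) (λ a → 𝟙 (lo ℕ.≟ toℕ a) * C (toℕ a)) ⟩
    ∑[ a ≤ n ] (between (suc lo) hi (toℕ a) * C (toℕ a)) + ∑[ a ≤ n ] (𝟙 (lo ℕ.≟ toℕ a) * C (toℕ a))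
      ≡⟨ cong₂ _+_ (sym (countBetween-chain-suc k (suc lo) hi)) (∑-pick (suc n) lo C (s≤s (≤-trans lo≤hi hi≤n))) ⟩
    countBetween (chain (suc k)) (suc lo) hi + C lo ∎
    where
    open ≡-Reasoning
    C : ℕ → ℕ
    C a = countBetween (chain k) a hi
    split : ∀ a → between lo hi a * C a ≡ between (suc lo) hi a * C a + 𝟙 (lo ℕ.≟ a) * C a
    split a = trans (cong (_* C a) (between-split a lo≤hi)) (*-distribʳ-+ (C a) (between (suc lo) hi a) _)

  countBetween-chain : ∀ k ℓ lo hi → ℓ + lo ≡ suc hi → hi ≤ n → countBetween (chain k) lo hi ≡ multichoose ℓ k
  countBetween-chain zero    ℓ       lo hi _ _ = countBetween-size-0 (_≺_ (chain 0)) (_≺?_ (chain 0)) lo hi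
  countBetween-chain (suc k) zero    lo hi refl _ = countBetween-chain-empty k hi
  countBetween-chain (suc k) (suc ℓ) lo hi ℓ+lo≡hi hi≤n = begin
    countBetween (chain (suc k)) lo hi
      ≡⟨ countBetween-chain-step k lo hi lo≤hi hi≤n ⟩
    countBetween (chain (suc k)) (suc lo) hi + countBetween (chain k) lo hi
      ≡⟨ cong₂ _+_ (countBetween-chain (suc k) ℓ (suc lo) hi (trans (+-suc ℓ lo) ℓ+lo≡hi) hi≤n)
                   (countBetween-chain k (suc ℓ) lo hi ℓ+lo≡hi hi≤n) ⟩
    multichoose ℓ (suc k) + multichoose (suc ℓ) k ∎
    where
    open ≡-Reasoning
    lo≤hi : lo ≤ hi
    lo≤hi = subst (lo ≤_) (suc-injective ℓ+lo≡hi) (m≤n+m lo ℓ)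

  ++-congˡ : ∀ {m₁ m₂} {w w′ : Point m₁} (z : Point m₂) → w ≗ w′ → (w VF.++ z) ≗ (w′ VF.++ z)
  ++-congˡ {m₁} z w≗w′ i with splitAt m₁ i
  ... | inj₁ j = w≗w′ j
  ... | inj₂ j = refl

  ++-congʳ : ∀ {m₁ m₂} (w : Point m₁) {z z′ : Point m₂} → z ≗ z′ → (w VF.++ z) ≗ (w VF.++ z′)
  ++-congʳ {m₁} w z≗z′ i with splitAt m₁ i
  ... | inj₁ j = refl
  ... | inj₂ j = z≗z′ j

  module _ (S : FinPoset) where

    private
      Q : FinPoset
      Q = (chain 1 ⊕P S) ⊕P chain 1

      s : ℕ
      s = size S

      I : Point (size Q) → ℕ
      I = 𝟙 ∘ inDilated? Q n

      I-ext : Extensional I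
      I-ext = inDilated-extensional Q

      values : List (Fin (suc n))
      values = allFin (suc n)

      single : Fin (suc n) → Point 1
      single a _ = a

      ends : Fin (suc n) → Point s → Fin (suc n) → Point (size Q)
      ends a y b = (single a VF.++ y) VF.++ single b

    InDilated-ends : ∀ a y b → InDilatedOrderPolytope Q n (ends a y b) ⇔ (toℕ a ≤ toℕ b × Admissible S (toℕ a) (toℕ b) y)
    InDilated-ends a y b = mk⇔ to from
      where
      mono₁ : ∀ (x : Point 1) → InDilatedOrderPolytope (chain 1) n x
      mono₁ x Fin.zero Fin.zero ()
      to : InDilatedOrderPolytope Q n (ends a y b) → toℕ a ≤ toℕ b × Admissible S (toℕ a) (toℕ b) y
      to mono =
        let (monoAy , _ , Ay≤b) = Equivalence.to (InDilated-⊕P (chain 1 ⊕P S) (chain 1) (single a VF.++ y) (single b)) mono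
            (_ , monoY , a≤y)   = Equivalence.to (InDilated-⊕P (chain 1) S (single a) y) monoAy
        in Ay≤b Fin.zero Fin.zero , monoY , λ j → a≤y Fin.zero j , Ay≤b (Fin.suc j) Fin.zero
      from : toℕ a ≤ toℕ b × Admissible S (toℕ a) (toℕ b) y → InDilatedOrderPolytope Q n (ends a y b)
      from (a≤b , monoY , bnd) = Equivalence.from (InDilated-⊕P (chain 1 ⊕P S) (chain 1) (single a VF.++ y) (single b))
        (Equivalence.from (InDilated-⊕P (chain 1) S (single a) y) (mono₁ _ , monoY , λ _ j → proj₁ (bnd j)) , mono₁ _ , below-b)
        where
        below-b : ∀ i j → toℕ ((single a VF.++ y) i) ≤ toℕ b
        below-b Fin.zero    _ = a≤b
        below-b (Fin.suc i) _ = proj₂ (bnd i)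

    ehr-as-sum-over-ends : ehr Q n ≡ ∑[ a ← values ] sumPoints s (λ y → ∑[ b ← values ] I (ends a y b))
    ehr-as-sum-over-ends = begin
      ehr Q n
        ≡⟨ length-filter (inDilated? Q n) (allFuns (size Q) (suc n)) ⟩
      sumPoints (suc s + 1) I
        ≡⟨ sumPoints-++ (suc s) 1 I I-ext ⟩
      sumPoints (suc s) (λ u → sumPoints 1 (λ v → I (u VF.++ v)))
        ≡⟨ sumPoints-++ 1 s _ (λ u≗u′ → sumPoints-cong 1 λ v → I-ext (++-congˡ v u≗u′)) ⟩
      sumPoints 1 (λ w → sumPoints s (λ y → sumPoints 1 (λ v → I ((w VF.++ y) VF.++ v))))
        ≡⟨ sumPoints-1 _ (λ w≗w′ → sumPoints-cong s λ y → sumPoints-cong 1 λ v → I-ext (++-congˡ v (++-congˡ y w≗w′))) ⟩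
      ∑[ a ← values ] sumPoints s (λ y → sumPoints 1 (λ v → I ((single a VF.++ y) VF.++ v)))
        ≡⟨ ∑-cong values (λ a → sumPoints-cong s λ y → sumPoints-1 _ (I-ext ∘ ++-congʳ (single a VF.++ y))) ⟩
      ∑[ a ← values ] sumPoints s (λ y → ∑[ b ← values ] I (ends a y b)) ∎
      where open ≡-Reasoning

    ehr-ends : ehr Q n ≡ ∑[ b ≤ n ] ∑[ a ≤ n ] (𝟙 (toℕ a ℕ.≤? toℕ b) * countBetween S (toℕ a) (toℕ b))
    ehr-ends = begin
      ehr Q n
        ≡⟨ ehr-as-sum-over-ends ⟩
      ∑[ a ← values ] sumPoints s (λ y → ∑[ b ← values ] I (ends a y b))
        ≡⟨ ∑-cong values (λ a → trans (sumPoints-cong s λ y → ∑-cong values λ b → factor a y b)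
                                      (∑-comm (allFuns s (suc n)) values _)) ⟩
      ∑[ a ← values ] ∑[ b ← values ] sumPoints s (λ y → ≤ᵢ a b * admissibleᵢ a b y)
        ≡⟨ ∑-cong values (λ a → ∑-cong values λ b → ∑-*ˡ (allFuns s (suc n)) (≤ᵢ a b) (admissibleᵢ a b)) ⟩
      ∑[ a ← values ] ∑[ b ← values ] (≤ᵢ a b * countBetween S (toℕ a) (toℕ b))
        ≡⟨ ∑-comm values values _ ⟩
      ∑[ b ← values ] ∑[ a ← values ] (≤ᵢ a b * countBetween S (toℕ a) (toℕ b))
        ≡⟨ trans (∑-cong values λ b → ∑-allFin (suc n) _) (∑-allFin (suc n) _) ⟩
      ∑[ b ≤ n ] ∑[ a ≤ n ] (≤ᵢ a b * countBetween S (toℕ a) (toℕ b)) ∎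
      where
      open ≡-Reasoning
      ≤ᵢ : Fin (suc n) → Fin (suc n) → ℕ
      ≤ᵢ a b = 𝟙 (toℕ a ℕ.≤? toℕ b)
      admissibleᵢ : Fin (suc n) → Fin (suc n) → Point s → ℕ
      admissibleᵢ a b = 𝟙 ∘ admissible? S (toℕ a) (toℕ b)
      factor : ∀ a y b → I (ends a y b) ≡ ≤ᵢ a b * admissibleᵢ a b y
      factor a y b = 𝟙-cong-× (InDilated-ends a y b) (inDilated? Q n (ends a y b))
                              (toℕ a ℕ.≤? toℕ b) (admissible? S (toℕ a) (toℕ b) y)

ehr-zero : ∀ P → ehr P 0 ≡ 1
ehr-zero P = begin
  ehr P 0                                        ≡⟨ length-filter (inDilated? P 0) (allFuns (size P) 1) ⟩
  sumPoints 0 (size P) (𝟙 ∘ inDilated? P 0)      ≡⟨ sumPoints-cong 0 (size P) (λ x → 𝟙-yes (inDilated? P 0 x) (constant x)) ⟩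
  sumPoints 0 (size P) (λ _ → 1)                 ≡⟨ one-point (size P) ⟩
  1                                              ∎
  where
  open ≡-Reasoning
  constant : ∀ x → InDilatedOrderPolytope P 0 x
  constant x i j _ with x i | x j
  ... | Fin.zero | Fin.zero = z≤n
  one-point : ∀ m → sumPoints 0 m (λ _ → 1) ≡ 1
  one-point zero    = refl
  one-point (suc m) = trans (sumPoints-∷ 0 m _) (trans (+-identityʳ _) (one-point m))

Ehr≗ehr : ∀ P → Ehr P ≗ ℤ.+_ ∘ ehr P
Ehr≗ehr P zero    = cong ℤ.+_ (sym (ehr-zero P))
Ehr≗ehr P (suc n) = refl

ehr-sumChains-multichoose : ∀ r (p : Fin r → ℕ) n →
  ehr ((chain 1 ⊕P sumChains r p) ⊕P chain 1) n ≡ psum (psum (λ t → ∏[ j < r ] multichoose (suc t) (p j))) n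
ehr-sumChains-multichoose r p n = begin
  ehr ((chain 1 ⊕P sumChains r p) ⊕P chain 1) n
    ≡⟨ ehr-ends n (sumChains r p) ⟩
  ∑[ b ≤ n ] ∑[ a ≤ n ] (𝟙 (toℕ a ℕ.≤? toℕ b) * countBetween n (sumChains r p) (toℕ a) (toℕ b))
    ≡⟨ sum-cong-≗ {suc n} (λ b → sum-cong-≗ {suc n} λ a → 𝟙-*-cong (chains a b) (toℕ a ℕ.≤? toℕ b)) ⟩
  ∑[ b ≤ n ] ∑[ a ≤ n ] (𝟙 (toℕ a ℕ.≤? toℕ b) * F (toℕ b ∸ toℕ a))
    ≡⟨ sum-cong-≗ {suc n} (λ b → ∑-truncate (suc n) (toℕ b) (λ a → F (toℕ b ∸ a)) (Finₚ.toℕ<n b)) ⟩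
  ∑[ b ≤ n ] ∑[ a ≤ toℕ b ] F (toℕ b ∸ toℕ a)
    ≡⟨ sum-cong-≗ {suc n} (λ b → ∑-reverse F (toℕ b)) ⟩
  ∑[ b ≤ n ] psum F (toℕ b)
    ≡⟨ ∑-psum (psum F) n ⟩
  psum (psum F) n ∎
  where
  open ≡-Reasoning
  F : ℕ → ℕ
  F t = ∏[ j < r ] multichoose (suc t) (p j)
  chains : ∀ (a b : Fin (suc n)) → toℕ a ≤ toℕ b →
           countBetween n (sumChains r p) (toℕ a) (toℕ b) ≡ F (toℕ b ∸ toℕ a)
  chains a b a≤b = trans (countBetween-sumChains n r p (toℕ a) (toℕ b))
    (∏-cong r λ j → countBetween-chain n (p j) (suc (toℕ b ∸ toℕ a)) (toℕ a) (toℕ b)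
                                       (cong suc (m∸n+n≡m a≤b)) (Finₚ.toℕ≤pred[n] b))

ehr-sumChains : ∀ r (p : Fin r → ℕ) n →
  ehr ((chain 1 ⊕P sumChains r p) ⊕P chain 1) n ≡ psum^ (total r p + 3) (descentCount r p) n
ehr-sumChains r p n = begin
  ehr ((chain 1 ⊕P sumChains r p) ⊕P chain 1) n                ≡⟨ ehr-sumChains-multichoose r p n ⟩
  psum (psum (λ t → ∏[ j < r ] multichoose (suc t) (p j))) n   ≡⟨ psum-cong (psum-cong (macMahonsIdentity p)) n ⟩
  psum^ (3 + total r p) (descentCount r p) n                   ≡⟨ cong (λ k → psum^ k (descentCount r p) n) (+-comm 3 (total r p)) ⟩
  psum^ (total r p + 3) (descentCount r p) n                   ∎
  where open ≡-Reasoning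

theorem4p1 : (r : ℕ) → r ≥ 1 → (p : Fin r → ℕ) → (∀ i → p i ≥ 1) →
    ∀ n → (Ehr ((chain 1 ⊕P sumChains r p) ⊕P chain 1) *S (oneMinusX ^S (total r p + 3))) n
          ≡ eulerianM r p n
theorem4p1 r _ p _ n = begin
  (Ehr Q *S (oneMinusX ^S K)) n               ≡⟨ *S-oneMinusX^ K (Ehr Q) n ⟩
  Δ^ K (Ehr Q) n                              ≡⟨ Δ^-cong K (λ m → trans (Ehr≗ehr Q m) (cong ℤ.+_ (ehr-sumChains r p m))) n ⟩
  Δ^ K (ℤ.+_ ∘ psum^ K (descentCount r p)) n  ≡⟨ Δ^-psum^ K (descentCount r p) n ⟩
  ℤ.+ descentCount r p n                      ≡⟨ cong ℤ.+_ (length-filter (λ π → des π ℕ.≟ n) (multiperms r p)) ⟨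
  eulerianM r p n                             ∎
  where
  open ≡-Reasoning
  Q : FinPoset
  Q = (chain 1 ⊕P sumChains r p) ⊕P chain 1
  K : ℕ
  K = total r p + 3
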